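{- Let $A_{i,j}(n)$ be the number of $3$-nonnesting open partition diagrams of size $n$ having exactly $i$ semi-arcs, exactly $j$ of which belong to some future $2$-nesting, and let $A(u,v)=A(u,v;z)=\sum_{i,j,n\ge 0}A_{i,j}(n)u^iv^jz^n$. Then \[ A(u,v)=1+z\left((1+u)A(u,v)+\Bigl(1+\frac1u\Bigr)\left(\frac{A(u,v)-A(uv,1)}{1-v}+\frac{A(u,v)-A(u,0)}{v}\right)\right). \]
   Context: An open partition diagram of size $n\ge 0$ consists of vertices $1,\dots,n$ in a row, a set of arcs $(a,b)$ with $1\le a<b\le n$ and a set of semi-arcs $(a,*)$ with $1\le a\le n$ (a semi-arc has a left end-point but no right end-point), such that every vertex is the left end-point of at most one arc or semi-arc and the right end-point of at most one arc. (Equivalently: a set partition of $\{1,\dots,n\}$ with each block marked closed or open; block $\{a_1<\dots<a_r\}$ gives arcs $(a_1,a_2),\dots,(a_{r-1},a_r)$ and, if open, the semi-arc $(a_r,*)$.) A $k$-nesting is a set of $k$ arcs $(i_1,j_1),\dots,(i_k,j_k)$ with $i_1<\dots<i_k<j_k<\dots<j_1$. A future $k$-nesting is a $(k-1)$-nesting $(i_2,j_2),\dots,(i_k,j_k)$ together with a semi-arc $(i_1,*)$ with $i_1<i_2$. An open partition diagram is $k$-nonnesting if it contains neither a $k$-nesting nor a future $k$-nesting. $A(u,0)$ and $A(uv,1)$ denote the obvious specializations of the formal power series. -}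

module Defs where

open import Data.Nat as ℕ using (ℕ; zero; suc)
open import Data.Integer as ℤ using (ℤ; +_; -[1+_])
open import Data.Fin using (Fin; _<_; _<?_)
open import Data.Fin.Properties using (any?; all?) renaming (_≟_ to _≟F_)
open import Data.Vec using (Vec; []; _∷_; lookup)
open import Data.List using (List; []; _∷_; map; concatMap; filter; length; allFin; _++_)
open import Data.Product using (_×_; _,_; ∃; ∃-syntax)
open import Relation.Nullary using (¬_; Dec; yes; no)
open import Relation.Nullary.Decidable using (_×-dec_; ¬?; map′)
open import Relation.Binary.PropositionalEquality using (_≡_; refl; cong)

-- Open partition diagrams of size n.
-- A diagram is encoded by recording, for each vertex a, what leaves a
-- to the right: nothing, a semi-arc (a,*), or an arc (a,b).

data Out (n : ℕ) : Set where
  none : Out n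
  semi : Out n
  arc  : Fin n → Out n

arc-inj : ∀ {n} {b c : Fin n} → arc b ≡ arc c → b ≡ c
arc-inj refl = refl

_≟O_ : ∀ {n} (x y : Out n) → Dec (x ≡ y)
none ≟O none = yes refl
none ≟O semi = no λ ()
none ≟O arc _ = no λ ()
semi ≟O none = no λ ()
semi ≟O semi = yes refl
semi ≟O arc _ = no λ ()
arc _ ≟O none = no λ ()
arc _ ≟O semi = no λ ()
arc b ≟O arc c = map′ (cong arc) arc-inj (b ≟F c)

Code : ℕ → Set
Code n = Vec (Out n) n

IsArc : ∀ {n} → Code n → Fin n → Fin n → Set
IsArc d a b = lookup d a ≡ arc b

IsSemi : ∀ {n} → Code n → Fin n → Set
IsSemi d a = lookup d a ≡ semi

-- a code is an open partition diagram iff every arc (a,b) has a < b and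
-- every vertex is the right end-point of at most one arc
-- (each vertex is automatically the left end-point of at most one arc/semi-arc).
IsDiagram : ∀ {n} → Code n → Set
IsDiagram {n} d =
  (∀ (a b : Fin n) → IsArc d a b → a < b) ×
  (∀ (a a' b : Fin n) → IsArc d a b → IsArc d a' b → a ≡ a')

Nest3 : ∀ {n} → Code n → Set
Nest3 d = ∃[ i₁ ] ∃[ i₂ ] ∃[ i₃ ] ∃[ j₃ ] ∃[ j₂ ] ∃[ j₁ ]
  (IsArc d i₁ j₁ × IsArc d i₂ j₂ × IsArc d i₃ j₃ ×
   i₁ < i₂ × i₂ < i₃ × i₃ < j₃ × j₃ < j₂ × j₂ < j₁)

FutureNest3 : ∀ {n} → Code n → Set
FutureNest3 d = ∃[ i₁ ] ∃[ i₂ ] ∃[ i₃ ] ∃[ j₃ ] ∃[ j₂ ]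
  (IsSemi d i₁ × IsArc d i₂ j₂ × IsArc d i₃ j₃ ×
   i₁ < i₂ × i₂ < i₃ × i₃ < j₃ × j₃ < j₂)

NonNesting3 : ∀ {n} → Code n → Set
NonNesting3 d = ¬ Nest3 d × ¬ FutureNest3 d

-- the semi-arc (a,*) belongs to some future 2-nesting:
-- there is an arc (i2,j2) (a 1-nesting) with a < i2
InFutureNest2 : ∀ {n} → Code n → Fin n → Set
InFutureNest2 d a = IsSemi d a × ∃[ i₂ ] ∃[ j₂ ] (IsArc d i₂ j₂ × a < i₂)

IsArc? : ∀ {n} (d : Code n) a b → Dec (IsArc d a b)
IsArc? d a b = lookup d a ≟O arc b

IsSemi? : ∀ {n} (d : Code n) a → Dec (IsSemi d a)
IsSemi? d a = lookup d a ≟O semi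

IsDiagram? : ∀ {n} (d : Code n) → Dec (IsDiagram d)
IsDiagram? d =
  all? (λ a → all? (λ b → map′ (λ f → f) (λ f → f) (decImp (IsArc? d a b) (a <? b))))
  ×-dec
  all? (λ a → all? (λ a' → all? (λ b →
    decImp (IsArc? d a b) (decImp (IsArc? d a' b) (a ≟F a')))))
  where
  decImp : ∀ {P Q : Set} → Dec P → Dec Q → Dec (P → Q)
  decImp (yes p) (yes q) = yes λ _ → q
  decImp (yes p) (no ¬q) = no λ f → ¬q (f p)
  decImp (no ¬p) _ = yes λ p → Data.Empty.⊥-elim (¬p p)
    where import Data.Empty

Nest3? : ∀ {n} (d : Code n) → Dec (Nest3 d)
Nest3? d = any? λ i₁ → any? λ i₂ → any? λ i₃ → any? λ j₃ → any? λ j₂ → any? λ j₁ →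
  IsArc? d i₁ j₁ ×-dec IsArc? d i₂ j₂ ×-dec IsArc? d i₃ j₃ ×-dec
  (i₁ <? i₂) ×-dec (i₂ <? i₃) ×-dec (i₃ <? j₃) ×-dec (j₃ <? j₂) ×-dec (j₂ <? j₁)

FutureNest3? : ∀ {n} (d : Code n) → Dec (FutureNest3 d)
FutureNest3? d = any? λ i₁ → any? λ i₂ → any? λ i₃ → any? λ j₃ → any? λ j₂ →
  IsSemi? d i₁ ×-dec IsArc? d i₂ j₂ ×-dec IsArc? d i₃ j₃ ×-dec
  (i₁ <? i₂) ×-dec (i₂ <? i₃) ×-dec (i₃ <? j₃) ×-dec (j₃ <? j₂)

NonNesting3? : ∀ {n} (d : Code n) → Dec (NonNesting3 d)
NonNesting3? d = ¬? (Nest3? d) ×-dec ¬? (FutureNest3? d)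

InFutureNest2? : ∀ {n} (d : Code n) a → Dec (InFutureNest2 d a)
InFutureNest2? d a = IsSemi? d a ×-dec (any? λ i₂ → any? λ j₂ → IsArc? d i₂ j₂ ×-dec (a <? i₂))

vecsOver : ∀ {A : Set} → List A → (m : ℕ) → List (Vec A m)
vecsOver xs zero = [] ∷ []
vecsOver xs (suc m) = concatMap (λ x → map (x ∷_) (vecsOver xs m)) xs

allOuts : (n : ℕ) → List (Out n)
allOuts n = none ∷ semi ∷ map arc (allFin n)

allCodes : (n : ℕ) → List (Code n)
allCodes n = vecsOver (allOuts n) n

semiArcs : ∀ {n} → Code n → ℕ
semiArcs {n} d = length (filter (IsSemi? d) (allFin n))

futureSemiArcs : ∀ {n} → Code n → ℕ
futureSemiArcs {n} d = length (filter (InFutureNest2? d) (allFin n))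

Acount : ℕ → ℕ → ℕ → ℕ
Acount n i j = length (filter
  (λ d → IsDiagram? d ×-dec NonNesting3? d ×-dec
         (semiArcs d ℕ.≟ i) ×-dec (futureSemiArcs d ℕ.≟ j))
  (allCodes n))

Bcount : ℕ → ℕ → ℕ
Bcount n i = length (filter
  (λ d → IsDiagram? d ×-dec NonNesting3? d ×-dec (semiArcs d ℕ.≟ i))
  (allCodes n))

-- Formal series in z, u, v: Laurent in u (exponent in ℤ), power series
-- in v and z.  S n i j = coefficient of z^n u^i v^j.

Ser : Set
Ser = ℕ → ℤ → ℕ → ℤ

_⊕_ : Ser → Ser → Ser
(S ⊕ T) n i j = S n i j ℤ.+ T n i j

_⊖_ : Ser → Ser → Ser
(S ⊖ T) n i j = S n i j ℤ.- T n i j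

𝟙 : Ser
𝟙 zero (+ zero) zero = + 1
𝟙 _ _ _ = + 0

z· : Ser → Ser
z· S zero i j = + 0
z· S (suc n) i j = S n i j

u· : Ser → Ser
u· S n i j = S n (i ℤ.- + 1) j

u⁻¹· : Ser → Ser
u⁻¹· S n i j = S n (i ℤ.+ + 1) j

-- multiplication by 1/(1-v) = Σ_k v^k  (the inverse of 1-v in the v-power series)
sumUpTo : (ℕ → ℤ) → ℕ → ℤ
sumUpTo f zero = f zero
sumUpTo f (suc k) = sumUpTo f k ℤ.+ f (suc k)

div1-v : Ser → Ser
div1-v S n i j = sumUpTo (S n i) j

-- division by v (exact for series with no v^0 terms, as A(u,v) - A(u,0))
div-v : Ser → Ser
div-v S n i j = S n i (suc j)

A : Ser
A n (+ i) j = + Acount n i j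
A n -[1+ _ ] j = + 0

-- A(uv,1) = Σ_{n,i} (Σ_j A_{i,j}(n)) u^i v^i z^n
A[uv,1] : Ser
A[uv,1] n -[1+ _ ] j = + 0
A[uv,1] n (+ i) j with j ℕ.≟ i
... | yes _ = + Bcount n i
... | no _ = + 0

A[u,0] : Ser
A[u,0] n -[1+ _ ] j = + 0
A[u,0] n (+ i) zero = + Acount n i 0
A[u,0] n (+ i) (suc _) = + 0

-- A diagram on n+1 vertices is determined by its restriction to the first n
-- vertices (an arc into vertex n+1 becoming a semi-arc), by whether vertex n+1
-- opens a semi-arc, and by which semi-arc, if any, it closes.  The extension is
-- 3-nonnesting iff the restriction is and the closed semi-arc a is not preceded
-- by a semi-arc while some arc starts right of a.  List the semi-arcs as
-- s₁ < … < sᵢ; those in a future 2-nesting are an initial segment s₁ … sⱼ.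
-- Closing s_k with k > j leaves k − 1 of them, closing s₁ with j ≥ 1 leaves
-- j − 1, so the admissible closings leaving J future semi-arcs number
-- [j ≤ J < i] + [j = J + 1].  Summing over diagrams gives
--   A_{I,J}(n+1) = A_{I,J}(n) + A_{I−1,J}(n) + X_{I,J}(n) + X_{I+1,J}(n),
--   X_{a,J}(n) = [J < a] Σ_{k ≤ J} A_{a,k}(n) + A_{a,J+1}(n),
-- and X_{a,J}(n) is the coefficient of u^a v^J z^n in
-- (A − A(uv,1))/(1 − v) + (A − A(u,0))/v because A_{a,k}(n) = 0 for k > a.

module Submission where

open import Level using (0ℓ)
open import Data.Bool.Base using (Bool; true; false; if_then_else_)
import Data.Bool.Properties as Bool
open import Data.Empty using (⊥; ⊥-elim)
open import Function.Base using (_∘_)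
open import Data.Fin.Base using (Fin; zero; suc; toℕ; inject₁; fromℕ; _<_)
import Data.Fin.Properties as Fin
open import Data.Fin.Properties using (any?; inject₁-injective; fromℕ≢inject₁)
open import Data.Integer.Base as ℤ using (ℤ)
import Data.Integer.Properties as ℤₚ
open import Data.List.Base as List using (List; []; _∷_; _++_; map; concatMap; filter; length; allFin)
open import Data.Maybe.Base as Maybe using (Maybe; just; nothing)
import Data.Maybe.Properties as Maybe
open import Data.Nat.Base as ℕ using (ℕ; zero; suc; _+_; _*_; _≤_; s≤s; z≤n)
import Data.Nat.Properties as ℕₚ
open import Data.Nat.Properties using (_≟_; _≤?_; _<?_; +-*-semiring)
open import Data.Nat.Solver using (module +-*-Solver)
open import Algebra.Properties.Semiring.Sum +-*-semiring
  using (sum-syntax; sum-cong-≗; sum-replicate-zero; sum-init-last; ∑-distrib-+; *-distribʳ-sum)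
open import Data.Product.Base using (_×_; _,_; proj₁; proj₂; ∃-syntax; ∃₂)
import Data.Product.Properties as Product
open import Data.Sum.Base using (_⊎_; inj₁; inj₂)
open import Data.Unit.Base using (⊤; tt)
open import Data.Vec.Base using ([]; _∷_; lookup; tabulate)
import Data.Vec.Properties as Vec
open import Relation.Binary.Definitions using (DecidableEquality; tri<; tri≈; tri>)
open import Relation.Binary.PropositionalEquality
  using (_≡_; _≢_; refl; sym; trans; cong; cong₂; subst; subst₂; module ≡-Reasoning)
open import Relation.Nullary using (¬_; Dec; yes; no; does)
open import Relation.Nullary.Decidable using (_×-dec_; _⊎-dec_; ¬?)
open import Relation.Unary using (Pred; Decidable)

open import Defs

⟦_⟧ : ∀ {p} {P : Set p} → Dec P → ℕ
⟦ P? ⟧ = if does P? then 1 else 0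

module _ {p} {P : Set p} where

  ⟦⟧-yes : (P? : Dec P) → P → ⟦ P? ⟧ ≡ 1
  ⟦⟧-yes (yes _) _ = refl
  ⟦⟧-yes (no ¬p) p = ⊥-elim (¬p p)

  ⟦⟧-no : (P? : Dec P) → ¬ P → ⟦ P? ⟧ ≡ 0
  ⟦⟧-no (yes p) ¬p = ⊥-elim (¬p p)
  ⟦⟧-no (no _) _ = refl

  *-⟦⟧-yes : ∀ x (P? : Dec P) → P → x * ⟦ P? ⟧ ≡ x
  *-⟦⟧-yes x P? p = trans (cong (x *_) (⟦⟧-yes P? p)) (ℕₚ.*-identityʳ x)

  *-⟦⟧-no : ∀ x (P? : Dec P) → ¬ P → x * ⟦ P? ⟧ ≡ 0
  *-⟦⟧-no x P? ¬p = trans (cong (x *_) (⟦⟧-no P? ¬p)) (ℕₚ.*-zeroʳ x)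

module _ {p q} {P : Set p} {Q : Set q} where

  ⟦⟧-cong : (P? : Dec P) (Q? : Dec Q) → (P → Q) → (Q → P) → ⟦ P? ⟧ ≡ ⟦ Q? ⟧
  ⟦⟧-cong (yes _) (yes _) _ _ = refl
  ⟦⟧-cong (yes p) (no ¬q) f _ = ⊥-elim (¬q (f p))
  ⟦⟧-cong (no ¬p) (yes q) _ g = ⊥-elim (¬p (g q))
  ⟦⟧-cong (no _) (no _) _ _ = refl

  ⟦⟧-mono : (P? : Dec P) (Q? : Dec Q) → (P → Q) → ⟦ P? ⟧ ≤ ⟦ Q? ⟧
  ⟦⟧-mono (yes p) (yes _) _ = ℕₚ.≤-refl
  ⟦⟧-mono (yes p) (no ¬q) f = ⊥-elim (¬q (f p))
  ⟦⟧-mono (no _) _ _ = z≤n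

  ⟦⟧-absorb : (P? : Dec P) (Q? : Dec Q) → (P → Q) → ⟦ P? ⟧ * ⟦ Q? ⟧ ≡ ⟦ P? ⟧
  ⟦⟧-absorb (yes p) (yes _) _ = refl
  ⟦⟧-absorb (yes p) (no ¬q) f = ⊥-elim (¬q (f p))
  ⟦⟧-absorb (no _) _ _ = refl

  ⟦⟧-× : (P? : Dec P) (Q? : Dec Q) → ⟦ P? ×-dec Q? ⟧ ≡ ⟦ P? ⟧ * ⟦ Q? ⟧
  ⟦⟧-× (yes _) (yes _) = refl
  ⟦⟧-× (yes _) (no _) = refl
  ⟦⟧-× (no _) _ = refl

private
  variable
    T U : Set

∑ˡ : List T → (T → ℕ) → ℕ
∑ˡ [] f = 0
∑ˡ (x ∷ xs) f = f x + ∑ˡ xs f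

infixl 10 ∑ˡ
syntax ∑ˡ xs (λ x → e) = ∑[ x ∈ xs ] e

∑ˡ-cong : ∀ (xs : List T) {f g : T → ℕ} → (∀ x → f x ≡ g x) → ∑ˡ xs f ≡ ∑ˡ xs g
∑ˡ-cong [] _ = refl
∑ˡ-cong (x ∷ xs) f≗g = cong₂ _+_ (f≗g x) (∑ˡ-cong xs f≗g)

∑ˡ-zero : ∀ (xs : List T) {f : T → ℕ} → (∀ x → f x ≡ 0) → ∑ˡ xs f ≡ 0
∑ˡ-zero [] _ = refl
∑ˡ-zero (x ∷ xs) f≗0 = cong₂ _+_ (f≗0 x) (∑ˡ-zero xs f≗0)

∑ˡ-++ : ∀ (xs ys : List T) (f : T → ℕ) → ∑ˡ (xs ++ ys) f ≡ ∑ˡ xs f + ∑ˡ ys f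
∑ˡ-++ [] ys f = refl
∑ˡ-++ (x ∷ xs) ys f = trans (cong (f x +_) (∑ˡ-++ xs ys f)) (sym (ℕₚ.+-assoc (f x) _ _))

∑ˡ-map : (g : T → U) (xs : List T) (f : U → ℕ) → ∑ˡ (map g xs) f ≡ ∑[ x ∈ xs ] f (g x)
∑ˡ-map g [] f = refl
∑ˡ-map g (x ∷ xs) f = cong (f (g x) +_) (∑ˡ-map g xs f)

∑ˡ-concatMap : (g : T → List U) (xs : List T) (f : U → ℕ) →
  ∑ˡ (concatMap g xs) f ≡ ∑[ x ∈ xs ] ∑ˡ (g x) f
∑ˡ-concatMap g [] f = refl
∑ˡ-concatMap g (x ∷ xs) f = trans (∑ˡ-++ (g x) (concatMap g xs) f) (cong (∑ˡ (g x) f +_) (∑ˡ-concatMap g xs f))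

∑ˡ-distrib-+ : ∀ (xs : List T) (f g : T → ℕ) → ∑[ x ∈ xs ] (f x + g x) ≡ ∑ˡ xs f + ∑ˡ xs g
∑ˡ-distrib-+ [] f g = refl
∑ˡ-distrib-+ (x ∷ xs) f g = trans (cong (f x + g x +_) (∑ˡ-distrib-+ xs f g))
  (solve 4 (λ a b c d → (a :+ b) :+ (c :+ d) := (a :+ c) :+ (b :+ d)) refl (f x) (g x) (∑ˡ xs f) (∑ˡ xs g))
  where open +-*-Solver using (solve; _:+_; _:=_)

*-distribˡ-∑ˡ : ∀ c (xs : List T) (f : T → ℕ) → c * ∑ˡ xs f ≡ ∑[ x ∈ xs ] (c * f x)
*-distribˡ-∑ˡ c [] f = ℕₚ.*-zeroʳ c
*-distribˡ-∑ˡ c (x ∷ xs) f = trans (ℕₚ.*-distribˡ-+ c (f x) _) (cong (c * f x +_) (*-distribˡ-∑ˡ c xs f))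

∑ˡ-comm : (xs : List T) (ys : List U) (h : T → U → ℕ) →
  ∑[ x ∈ xs ] ∑[ y ∈ ys ] h x y ≡ ∑[ y ∈ ys ] ∑[ x ∈ xs ] h x y
∑ˡ-comm [] ys h = sym (∑ˡ-zero ys (λ _ → refl))
∑ˡ-comm (x ∷ xs) ys h =
  trans (cong (∑ˡ ys (h x) +_) (∑ˡ-comm xs ys h)) (sym (∑ˡ-distrib-+ ys (h x) _))

length-filter : ∀ {P : Pred T 0ℓ} (P? : Decidable P) (xs : List T) → length (filter P? xs) ≡ ∑[ x ∈ xs ] ⟦ P? x ⟧
length-filter P? [] = refl
length-filter P? (x ∷ xs) with P? x
... | yes _ = cong suc (length-filter P? xs)
... | no _ = length-filter P? xs

∑ˡ-tabulate : ∀ n (g : Fin n → T) (f : T → ℕ) → ∑ˡ (List.tabulate g) f ≡ ∑[ i < n ] f (g i)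
∑ˡ-tabulate zero g f = refl
∑ˡ-tabulate (suc n) g f = cong (f (g zero) +_) (∑ˡ-tabulate n (λ i → g (suc i)) f)

∑ˡ-allFin : ∀ n (f : Fin n → ℕ) → ∑ˡ (allFin n) f ≡ ∑[ i < n ] f i
∑ˡ-allFin n f = ∑ˡ-tabulate n (λ i → i) f

*-distribʳ-∑ˡ : ∀ c (xs : List T) (f : T → ℕ) → ∑ˡ xs f * c ≡ ∑[ x ∈ xs ] (f x * c)
*-distribʳ-∑ˡ c xs f =
  trans (ℕₚ.*-comm (∑ˡ xs f) c) (trans (*-distribˡ-∑ˡ c xs f) (∑ˡ-cong xs (λ x → ℕₚ.*-comm c (f x))))

multiplicity : DecidableEquality T → T → List T → ℕ
multiplicity _≟_ x xs = ∑[ y ∈ xs ] ⟦ y ≟ x ⟧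

record Enumerates (_≟_ : DecidableEquality T) (xs : List T) : Set where
  constructor enumerates
  field multiplicity≡1 : ∀ x → multiplicity _≟_ x xs ≡ 1
open Enumerates

∑ˡ-picks : ∀ {_≟_ : DecidableEquality T} {xs} → Enumerates _≟_ xs → ∀ c x → ∑[ y ∈ xs ] (c * ⟦ y ≟ x ⟧) ≡ c
∑ˡ-picks {xs = xs} enum c x = trans (sym (*-distribˡ-∑ˡ c xs _)) (trans (cong (c *_) (multiplicity≡1 enum x)) (ℕₚ.*-identityʳ c))

module _ {_≟T_ : DecidableEquality T} {_≟U_ : DecidableEquality U} {xs : List T} {ys : List U}
  (enum-xs : Enumerates _≟T_ xs) (enum-ys : Enumerates _≟U_ ys)
  {P : Pred T 0ℓ} {Q : Pred U 0ℓ} (P? : Decidable P) (Q? : Decidable Q)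
  (f : T → U) (g : U → T) (f-resp : ∀ x → P x → Q (f x)) (g-resp : ∀ y → Q y → P (g y))
  (g∘f : ∀ x → P x → g (f x) ≡ x) (f∘g : ∀ y → Q y → f (g y) ≡ y) where

  count-bijection : ∑[ x ∈ xs ] ⟦ P? x ⟧ ≡ ∑[ y ∈ ys ] ⟦ Q? y ⟧
  count-bijection = begin
    ∑[ x ∈ xs ] ⟦ P? x ⟧                           ≡⟨ ∑ˡ-cong xs (λ x → ∑ˡ-picks enum-ys ⟦ P? x ⟧ (f x)) ⟨
    ∑[ x ∈ xs ] ∑[ y ∈ ys ] (⟦ P? x ⟧ * ⟦ y ≟U f x ⟧) ≡⟨ ∑ˡ-comm xs ys _ ⟩
    ∑[ y ∈ ys ] ∑[ x ∈ xs ] (⟦ P? x ⟧ * ⟦ y ≟U f x ⟧) ≡⟨ ∑ˡ-cong ys (λ y → ∑ˡ-cong xs (graph y)) ⟩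
    ∑[ y ∈ ys ] ∑[ x ∈ xs ] (⟦ Q? y ⟧ * ⟦ x ≟T g y ⟧) ≡⟨ ∑ˡ-cong ys (λ y → ∑ˡ-picks enum-xs ⟦ Q? y ⟧ (g y)) ⟩
    ∑[ y ∈ ys ] ⟦ Q? y ⟧                           ∎
    where
    open ≡-Reasoning
    graph : ∀ y x → ⟦ P? x ⟧ * ⟦ y ≟U f x ⟧ ≡ ⟦ Q? y ⟧ * ⟦ x ≟T g y ⟧
    graph y x = begin
      ⟦ P? x ⟧ * ⟦ y ≟U f x ⟧     ≡⟨ ⟦⟧-× (P? x) (y ≟U f x) ⟨
      ⟦ P? x ×-dec y ≟U f x ⟧    ≡⟨ ⟦⟧-cong (P? x ×-dec y ≟U f x) (Q? y ×-dec x ≟T g y) to from ⟩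
      ⟦ Q? y ×-dec x ≟T g y ⟧    ≡⟨ ⟦⟧-× (Q? y) (x ≟T g y) ⟩
      ⟦ Q? y ⟧ * ⟦ x ≟T g y ⟧     ∎
      where
      to : P x × y ≡ f x → Q y × x ≡ g y
      to (p , refl) = f-resp x p , sym (g∘f x p)
      from : Q y × x ≡ g y → P x × y ≡ f x
      from (q , refl) = g-resp y q , sym (f∘g y q)

module _ {V : Set} {_≟T_ : DecidableEquality T} {_≟U_ : DecidableEquality U} {_≟V_ : DecidableEquality V}
  (c : T → U → V) (c-injective : ∀ {x y a b} → c x y ≡ c a b → x ≡ a × y ≡ b) where

  multiplicity-pairs : ∀ a b xs ys →
    multiplicity _≟V_ (c a b) (concatMap (λ x → map (c x) ys) xs) ≡ multiplicity _≟T_ a xs * multiplicity _≟U_ b ys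
  multiplicity-pairs a b xs ys = begin
    ∑ˡ (concatMap (λ x → map (c x) ys) xs) (λ v → ⟦ v ≟V c a b ⟧) ≡⟨ ∑ˡ-concatMap _ xs _ ⟩
    ∑[ x ∈ xs ] ∑ˡ (map (c x) ys) (λ v → ⟦ v ≟V c a b ⟧)          ≡⟨ ∑ˡ-cong xs (λ x → ∑ˡ-map (c x) ys _) ⟩
    ∑[ x ∈ xs ] ∑[ y ∈ ys ] ⟦ c x y ≟V c a b ⟧                  ≡⟨ ∑ˡ-cong xs (λ x → ∑ˡ-cong ys (componentwise x)) ⟩
    ∑[ x ∈ xs ] ∑[ y ∈ ys ] (⟦ x ≟T a ⟧ * ⟦ y ≟U b ⟧)            ≡⟨ ∑ˡ-cong xs (λ x → *-distribˡ-∑ˡ ⟦ x ≟T a ⟧ ys _) ⟨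
    ∑[ x ∈ xs ] (⟦ x ≟T a ⟧ * multiplicity _≟U_ b ys)           ≡⟨ *-distribʳ-∑ˡ _ xs _ ⟨
    multiplicity _≟T_ a xs * multiplicity _≟U_ b ys           ∎
    where
    open ≡-Reasoning
    componentwise : ∀ x y → ⟦ c x y ≟V c a b ⟧ ≡ ⟦ x ≟T a ⟧ * ⟦ y ≟U b ⟧
    componentwise x y = trans (⟦⟧-cong (c x y ≟V c a b) (x ≟T a ×-dec y ≟U b) c-injective (λ { (refl , refl) → refl }))
                              (⟦⟧-× (x ≟T a) (y ≟U b))

  pairs-enumerates : ∀ {xs ys} → Enumerates _≟T_ xs → Enumerates _≟U_ ys →
    (∀ v → ∃₂ λ a b → v ≡ c a b) → Enumerates _≟V_ (concatMap (λ x → map (c x) ys) xs)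
  pairs-enumerates {xs} {ys} enum-xs enum-ys surj = enumerates λ v → helper v (surj v)
    where
    helper : ∀ v → ∃₂ (λ a b → v ≡ c a b) → multiplicity _≟V_ v (concatMap (λ x → map (c x) ys) xs) ≡ 1
    helper _ (a , b , refl) =
      trans (multiplicity-pairs a b xs ys) (cong₂ _*_ (multiplicity≡1 enum-xs a) (multiplicity≡1 enum-ys b))

multiplicity-map : ∀ (_≟T_ : DecidableEquality T) (_≟U_ : DecidableEquality U) (c : T → U) →
  (∀ {x y} → c x ≡ c y → x ≡ y) → ∀ a xs → multiplicity _≟U_ (c a) (map c xs) ≡ multiplicity _≟T_ a xs
multiplicity-map _≟T_ _≟U_ c c-injective a xs =
  trans (∑ˡ-map c xs _) (∑ˡ-cong xs (λ x → ⟦⟧-cong (c x ≟U c a) (x ≟T a) c-injective (cong c)))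

multiplicity-map-∉ : ∀ (_≟U_ : DecidableEquality U) (c : T → U) b → (∀ x → c x ≢ b) → ∀ xs →
  multiplicity _≟U_ b (map c xs) ≡ 0
multiplicity-map-∉ _≟U_ c b c≢b xs = trans (∑ˡ-map c xs _) (∑ˡ-zero xs (λ x → ⟦⟧-no (c x ≟U b) (c≢b x)))

∑-zero : ∀ n {f : Fin n → ℕ} → (∀ i → f i ≡ 0) → ∑[ i < n ] f i ≡ 0
∑-zero n f≗0 = trans (sum-cong-≗ {n} f≗0) (sum-replicate-zero n)

∑-δ : ∀ n (a : Fin n) → ∑[ b < n ] ⟦ b Fin.≟ a ⟧ ≡ 1
∑-δ (suc n) zero =
  cong (1 +_) (∑-zero n (λ b → ⟦⟧-no (suc b Fin.≟ zero) λ ()))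
∑-δ (suc n) (suc a) =
  trans (cong₂ _+_ (⟦⟧-no (zero Fin.≟ suc a) λ ())
                   (sum-cong-≗ {n} (λ b → ⟦⟧-cong (suc b Fin.≟ suc a) (b Fin.≟ a) Fin.suc-injective (cong suc))))
        (∑-δ n a)

∑-zero⇒ : ∀ n (f : Fin n → ℕ) → ∑[ i < n ] f i ≡ 0 → ∀ i → f i ≡ 0
∑-zero⇒ (suc n) f ∑≡0 zero = ℕₚ.m+n≡0⇒m≡0 (f zero) ∑≡0
∑-zero⇒ (suc n) f ∑≡0 (suc i) = ∑-zero⇒ n (λ i → f (suc i)) (ℕₚ.m+n≡0⇒n≡0 (f zero) ∑≡0) i

∑-nonzero⇒ : ∀ n (f : Fin n → ℕ) → ∑[ i < n ] f i ≢ 0 → ∃[ i ] f i ≢ 0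
∑-nonzero⇒ zero f ∑≢0 = ⊥-elim (∑≢0 refl)
∑-nonzero⇒ (suc n) f ∑≢0 with f zero ≟ 0
... | no f₀≢0 = zero , f₀≢0
... | yes f₀≡0 with ∑-nonzero⇒ n (λ i → f (suc i)) (λ ∑≡0 → ∑≢0 (cong₂ _+_ f₀≡0 ∑≡0))
...   | i , fᵢ≢0 = suc i , fᵢ≢0

∑-remove : ∀ n {P : Pred (Fin n) 0ℓ} (P? : Decidable P) (a : Fin n) → P a →
  ∑[ s < n ] (⟦ P? s ⟧ * ⟦ ¬? (s Fin.≟ a) ⟧) + 1 ≡ ∑[ s < n ] ⟦ P? s ⟧
∑-remove n P? a Pa = begin
  ∑[ s < n ] (⟦ P? s ⟧ * ⟦ ¬? (s Fin.≟ a) ⟧) + 1                         ≡⟨ cong (∑[ s < n ] (⟦ P? s ⟧ * ⟦ ¬? (s Fin.≟ a) ⟧) +_) (∑-δ n a) ⟨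
  ∑[ s < n ] (⟦ P? s ⟧ * ⟦ ¬? (s Fin.≟ a) ⟧) + ∑[ s < n ] ⟦ s Fin.≟ a ⟧   ≡⟨ ∑-distrib-+ (λ s → ⟦ P? s ⟧ * ⟦ ¬? (s Fin.≟ a) ⟧) (λ s → ⟦ s Fin.≟ a ⟧) ⟨
  ∑[ s < n ] (⟦ P? s ⟧ * ⟦ ¬? (s Fin.≟ a) ⟧ + ⟦ s Fin.≟ a ⟧)             ≡⟨ sum-cong-≗ {n} split ⟩
  ∑[ s < n ] ⟦ P? s ⟧                                                  ∎
  where
  open ≡-Reasoning
  split : ∀ s → ⟦ P? s ⟧ * ⟦ ¬? (s Fin.≟ a) ⟧ + ⟦ s Fin.≟ a ⟧ ≡ ⟦ P? s ⟧
  split s with s Fin.≟ a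
  ... | yes refl = trans (cong (_+ 1) (ℕₚ.*-zeroʳ ⟦ P? s ⟧)) (sym (⟦⟧-yes (P? s) Pa))
  ... | no _ = trans (ℕₚ.+-identityʳ _) (ℕₚ.*-identityʳ _)

allFin-enumerates : ∀ n → Enumerates Fin._≟_ (allFin n)
allFin-enumerates n = enumerates λ a → trans (∑ˡ-allFin n _) (∑-δ n a)

vecsOver-enumerates : ∀ {_≟_ : DecidableEquality T} {xs} → Enumerates _≟_ xs →
  ∀ m → Enumerates (Vec.≡-dec _≟_) (vecsOver xs m)
vecsOver-enumerates enum zero = enumerates λ { [] → refl }
vecsOver-enumerates enum (suc m) =
  pairs-enumerates _∷_ Vec.∷-injective enum (vecsOver-enumerates enum m) λ { (x ∷ v) → x , v , refl }

data InitLast {n : ℕ} : Fin (suc n) → Set where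
  initial : (a : Fin n) → InitLast (inject₁ a)
  last : InitLast (fromℕ n)

initLast : ∀ {n} (p : Fin (suc n)) → InitLast p
initLast {zero} zero = last
initLast {suc n} zero = initial zero
initLast {suc n} (suc p) with initLast p
... | initial a = initial (suc a)
... | last = last

toInit : ∀ {n} → Fin (suc n) → Maybe (Fin n)
toInit {zero} zero = nothing
toInit {suc n} zero = just zero
toInit {suc n} (suc p) = Maybe.map suc (toInit p)

toInit-inject₁ : ∀ {n} (a : Fin n) → toInit (inject₁ a) ≡ just a
toInit-inject₁ {suc n} zero = refl
toInit-inject₁ {suc n} (suc a) = cong (Maybe.map suc) (toInit-inject₁ a)

toInit-fromℕ : ∀ n → toInit (fromℕ n) ≡ nothing
toInit-fromℕ zero = refl
toInit-fromℕ (suc n) = cong (Maybe.map suc) (toInit-fromℕ n)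

toInit≡just : ∀ {n} (q : Fin (suc n)) {b : Fin n} → toInit q ≡ just b → q ≡ inject₁ b
toInit≡just {n} q eq with initLast q
... | initial a = cong inject₁ (Maybe.just-injective (trans (sym (toInit-inject₁ a)) eq))
... | last with () ← trans (sym (toInit-fromℕ n)) eq

toInit≡nothing : ∀ {n} (q : Fin (suc n)) → toInit q ≡ nothing → q ≡ fromℕ n
toInit≡nothing q eq with initLast q
... | initial a with () ← trans (sym (toInit-inject₁ a)) eq
... | last = refl

fromℕ-maximal : ∀ {n} (q : Fin (suc n)) → ¬ (fromℕ n < q)
fromℕ-maximal {n} q fromℕ<q = ℕₚ.<⇒≱ fromℕ<q (Fin.≤fromℕ q)

inject₁<fromℕ : ∀ {n} (a : Fin n) → inject₁ a < fromℕ n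
inject₁<fromℕ {n} a = subst (toℕ (inject₁ a) ℕ.<_) (sym (Fin.toℕ-fromℕ n)) (Fin.inject₁ℕ< a)

inject₁-mono-< : ∀ {n} {a b : Fin n} → a < b → inject₁ a < inject₁ b
inject₁-mono-< {a = a} {b} = subst₂ ℕ._<_ (sym (Fin.toℕ-inject₁ a)) (sym (Fin.toℕ-inject₁ b))

inject₁-cancel-< : ∀ {n} {a b : Fin n} → inject₁ a < inject₁ b → a < b
inject₁-cancel-< {a = a} {b} = subst₂ ℕ._<_ (Fin.toℕ-inject₁ a) (Fin.toℕ-inject₁ b)

allOuts-enumerates : ∀ n → Enumerates _≟O_ (allOuts n)
allOuts-enumerates n = enumerates λ where
    none → cong suc (multiplicity-map-∉ _≟O_ arc none (λ _ ()) (allFin n))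
    semi → cong suc (multiplicity-map-∉ _≟O_ arc semi (λ _ ()) (allFin n))
    (arc b) → trans (multiplicity-map Fin._≟_ _≟O_ arc arc-inj b (allFin n)) (multiplicity≡1 (allFin-enumerates n) b)

_≟C_ : ∀ {n} → DecidableEquality (Code n)
_≟C_ = Vec.≡-dec _≟O_

allCodes-enumerates : ∀ n → Enumerates _≟C_ (allCodes n)
allCodes-enumerates n = vecsOver-enumerates (allOuts-enumerates n) n

_≟M_ : ∀ {n} → DecidableEquality (Maybe (Fin n))
_≟M_ = Maybe.≡-dec Fin._≟_

-- Vertex n+1 may open a semi-arc and may be the end of an arc from a semi-arc of
-- the first n vertices.
Choice : ℕ → Set
Choice n = Bool × Maybe (Fin n)

_≟Ch_ : ∀ {n} → DecidableEquality (Choice n)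
_≟Ch_ = Product.≡-dec Bool._≟_ _≟M_

maybeFins : ∀ n → List (Maybe (Fin n))
maybeFins n = nothing ∷ map just (allFin n)

choices : ∀ n → List (Choice n)
choices n = concatMap (λ b → map (b ,_) (maybeFins n)) (false ∷ true ∷ [])

choices-enumerates : ∀ n → Enumerates _≟Ch_ (choices n)
choices-enumerates n =
  pairs-enumerates _,_ Product.,-injective bools maybes (λ (b , m) → b , m , refl)
  where
  bools : Enumerates Bool._≟_ (false ∷ true ∷ [])
  bools = enumerates λ { false → refl ; true → refl }
  maybes : Enumerates _≟M_ (maybeFins n)
  maybes = enumerates λ where
    nothing → cong suc (multiplicity-map-∉ _≟M_ just nothing (λ _ ()) (allFin n))
    (just a) → trans (multiplicity-map Fin._≟_ _≟M_ just Maybe.just-injective a (allFin n))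
                     (multiplicity≡1 (allFin-enumerates n) a)

Extension : ℕ → Set
Extension n = Code n × Choice n

_≟E_ : ∀ {n} → DecidableEquality (Extension n)
_≟E_ = Product.≡-dec _≟C_ _≟Ch_

extensions : ∀ n → List (Extension n)
extensions n = concatMap (λ d → map (d ,_) (choices n)) (allCodes n)

extensions-enumerates : ∀ n → Enumerates _≟E_ (extensions n)
extensions-enumerates n =
  pairs-enumerates _,_ Product.,-injective (allCodes-enumerates n) (choices-enumerates n) (λ (d , c) → d , c , refl)

closer : ∀ {n} → Code (suc n) → Maybe (Fin n)
closer e with any? (λ a → IsArc? e (inject₁ a) (fromℕ _))
... | yes (a , _) = just a
... | no _ = nothing

closer-sound : ∀ {n} (e : Code (suc n)) {a} → closer e ≡ just a → IsArc e (inject₁ a) (fromℕ n)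
closer-sound e eq with any? (λ a → IsArc? e (inject₁ a) (fromℕ _))
closer-sound e refl | yes (a , a→last) = a→last

closer-nothing : ∀ {n} (e : Code (suc n)) → (∀ a → ¬ IsArc e (inject₁ a) (fromℕ n)) → closer e ≡ nothing
closer-nothing e none-closes with any? (λ a → IsArc? e (inject₁ a) (fromℕ _))
... | yes (a , a→last) = ⊥-elim (none-closes a a→last)
... | no _ = refl

closer-just : ∀ {n} (e : Code (suc n)) {a} → IsArc e (inject₁ a) (fromℕ n) →
  (∀ b → IsArc e (inject₁ b) (fromℕ n) → b ≡ a) → closer e ≡ just a
closer-just e {a} a→last unique with any? (λ a → IsArc? e (inject₁ a) (fromℕ _))
... | yes (b , b→last) = cong just (unique b b→last)
... | no no-closer = ⊥-elim (no-closer (a , a→last))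

extendOut : ∀ {n} → Out n → Out (suc n)
extendOut none = none
extendOut semi = semi
extendOut (arc b) = arc (inject₁ b)

restrictOut : ∀ {n} → Out (suc n) → Out n
restrictOut none = none
restrictOut semi = semi
restrictOut (arc q) with toInit q
... | just b = arc b
... | nothing = semi

lastOut : ∀ {n} → Bool → Out n
lastOut true = semi
lastOut false = none

isSemi : ∀ {n} → Out n → Bool
isSemi semi = true
isSemi _ = false

extendAt : ∀ {n} → Code n → Choice n → Maybe (Fin n) → Out (suc n)
extendAt {n} d (_ , closes) (just a) = if does (closes ≟M just a) then arc (fromℕ n) else extendOut (lookup d a)
extendAt d (opens , _) nothing = lastOut opens

extend : ∀ {n} → Extension n → Code (suc n)
extend (d , c) = tabulate (λ p → extendAt d c (toInit p))

restrict : ∀ {n} → Code (suc n) → Extension n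
restrict {n} e = tabulate (λ a → restrictOut (lookup e (inject₁ a))) , isSemi (lookup e (fromℕ n)) , closer e

-- Closing the semi-arc at a by an arc into a new last vertex would create a
-- future 3-nesting.
Blocked : ∀ {n} → Code n → Fin n → Set
Blocked d a = ∃[ s ] ∃[ p ] ∃[ q ] (IsSemi d s × s < a × IsArc d p q × a < p)

CanClose : ∀ {n} → Code n → Maybe (Fin n) → Set
CanClose d nothing = ⊤
CanClose d (just a) = IsSemi d a × ¬ Blocked d a

Valid : ∀ {n} → Code n → Set
Valid d = IsDiagram d × NonNesting3 d

restrictOut-extendOut : ∀ {n} (x : Out n) → restrictOut (extendOut x) ≡ x
restrictOut-extendOut none = refl
restrictOut-extendOut semi = refl
restrictOut-extendOut (arc b) rewrite toInit-inject₁ b = refl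

extendOut-restrictOut : ∀ {n} (x : Out (suc n)) → x ≢ arc (fromℕ n) → extendOut (restrictOut x) ≡ x
extendOut-restrictOut none _ = refl
extendOut-restrictOut semi _ = refl
extendOut-restrictOut (arc q) x≢last with toInit q in eq
... | just b = cong arc (sym (toInit≡just q eq))
... | nothing = ⊥-elim (x≢last (cong arc (toInit≡nothing q eq)))

restrictOut-last : ∀ n → restrictOut (arc (fromℕ n)) ≡ semi
restrictOut-last n rewrite toInit-fromℕ n = refl

restrictOut≡arc : ∀ {n} (x : Out (suc n)) {b : Fin n} → restrictOut x ≡ arc b → x ≡ arc (inject₁ b)
restrictOut≡arc (arc q) eq with toInit q in eq′
restrictOut≡arc (arc q) refl | just b = cong arc (toInit≡just q eq′)

restrictOut≡semi : ∀ {n} (x : Out (suc n)) → restrictOut x ≡ semi → x ≡ semi ⊎ x ≡ arc (fromℕ n)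
restrictOut≡semi semi _ = inj₁ refl
restrictOut≡semi (arc q) eq with toInit q in eq′
restrictOut≡semi (arc q) refl | nothing = inj₂ (cong arc (toInit≡nothing q eq′))

isSemi-lastOut : ∀ {n} b → isSemi {n} (lastOut b) ≡ b
isSemi-lastOut true = refl
isSemi-lastOut false = refl

lastOut-isSemi : ∀ {n} (x : Out n) → (∀ q → x ≢ arc q) → lastOut (isSemi x) ≡ x
lastOut-isSemi none _ = refl
lastOut-isSemi semi _ = refl
lastOut-isSemi (arc q) not-arc = ⊥-elim (not-arc q refl)

lastOut≢arc : ∀ {n} b {q : Fin n} → lastOut b ≢ arc q
lastOut≢arc true ()
lastOut≢arc false ()

module Extend {n : ℕ} (d : Code n) (opens : Bool) (closes : Maybe (Fin n)) where

  e : Code (suc n)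
  e = extend (d , opens , closes)

  private
    entryAt : Maybe (Fin n) → Out (suc n)
    entryAt = extendAt d (opens , closes)

  lookup-inject₁ : ∀ a → lookup e (inject₁ a) ≡ entryAt (just a)
  lookup-inject₁ a = trans (Vec.lookup∘tabulate (entryAt ∘ toInit) (inject₁ a)) (cong entryAt (toInit-inject₁ a))

  lookup-fromℕ : lookup e (fromℕ n) ≡ lastOut opens
  lookup-fromℕ = trans (Vec.lookup∘tabulate (entryAt ∘ toInit) (fromℕ n)) (cong entryAt (toInit-fromℕ n))

  data ArcView (p q : Fin (suc n)) : Set where
    kept : ∀ a b → p ≡ inject₁ a → q ≡ inject₁ b → IsArc d a b → closes ≢ just a → ArcView p q
    closing : ∀ a → p ≡ inject₁ a → q ≡ fromℕ n → closes ≡ just a → ArcView p q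

  arcView : ∀ p q → IsArc e p q → ArcView p q
  arcView p q p→q with initLast p
  ... | last = ⊥-elim (lastOut≢arc opens (trans (sym lookup-fromℕ) p→q))
  ... | initial a with closes ≟M just a | trans (sym (lookup-inject₁ a)) p→q
  ...   | yes closes-a | last≡q = closing a refl (sym (arc-inj last≡q)) closes-a
  ...   | no ¬closes-a | eq with lookup d a in eqd
  ...     | arc b = kept a b refl (sym (arc-inj eq)) eqd ¬closes-a

  data SemiView (p : Fin (suc n)) : Set where
    kept : ∀ s → p ≡ inject₁ s → IsSemi d s → closes ≢ just s → SemiView p
    opened : p ≡ fromℕ n → SemiView p

  semiView : ∀ p → IsSemi e p → SemiView p
  semiView p p-semi with initLast p
  ... | last = opened refl
  ... | initial a with closes ≟M just a | trans (sym (lookup-inject₁ a)) p-semi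
  ...   | no ¬closes-a | eq with lookup d a in eqd
  ...     | semi = kept a refl eqd ¬closes-a

  arc-kept : ∀ {a b} → IsArc d a b → closes ≢ just a → IsArc e (inject₁ a) (inject₁ b)
  arc-kept {a} a→b ¬closes-a = trans (lookup-inject₁ a) entry
    where
    entry : extendAt d (opens , closes) (just a) ≡ arc (inject₁ _)
    entry with closes ≟M just a
    ... | yes closes-a = ⊥-elim (¬closes-a closes-a)
    ... | no _ = cong extendOut a→b

  arc-closing : ∀ {a} → closes ≡ just a → IsArc e (inject₁ a) (fromℕ n)
  arc-closing {a} closes-a = trans (lookup-inject₁ a) entry
    where
    entry : extendAt d (opens , closes) (just a) ≡ arc (fromℕ n)
    entry with closes ≟M just a
    ... | yes _ = refl
    ... | no ¬closes-a = ⊥-elim (¬closes-a closes-a)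

  semi-kept : ∀ {s} → IsSemi d s → closes ≢ just s → IsSemi e (inject₁ s)
  semi-kept {s} s-semi ¬closes-s = trans (lookup-inject₁ s) entry
    where
    entry : extendAt d (opens , closes) (just s) ≡ semi
    entry with closes ≟M just s
    ... | yes closes-s = ⊥-elim (¬closes-s closes-s)
    ... | no _ = cong extendOut s-semi

  semi-inject₁ : ∀ a → IsSemi e (inject₁ a) → IsSemi d a × closes ≢ just a
  semi-inject₁ a a-semi with semiView _ a-semi
  ... | opened eq = ⊥-elim (fromℕ≢inject₁ (sym eq))
  ... | kept s eq s-semi ¬closes-s with inject₁-injective {i = a} {j = s} eq
  ...   | refl = s-semi , ¬closes-s

  extend-isDiagram : IsDiagram d → IsDiagram e
  extend-isDiagram (forward , injective) = forward′ , injective′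
    where
    forward′ : ∀ p q → IsArc e p q → p < q
    forward′ p q p→q with arcView p q p→q
    ... | kept a b refl refl a→b _ = inject₁-mono-< (forward a b a→b)
    ... | closing a refl refl _ = inject₁<fromℕ a
    injective′ : ∀ p p′ q → IsArc e p q → IsArc e p′ q → p ≡ p′
    injective′ p p′ q p→q p′→q = same-target (arcView p q p→q) (arcView p′ q p′→q)
      where
      same-target : ArcView p q → ArcView p′ q → p ≡ p′
      same-target (kept a b refl q≡b a→b _) (kept a′ b′ refl q≡b′ a′→b′ _) =
        cong inject₁ (injective a a′ b a→b (subst (IsArc d a′) (inject₁-injective (trans (sym q≡b′) q≡b)) a′→b′))
      same-target (kept _ _ _ q≡b _ _) (closing _ _ q≡last _) = ⊥-elim (fromℕ≢inject₁ (trans (sym q≡last) q≡b))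
      same-target (closing _ _ q≡last _) (kept _ _ _ q≡b _ _) = ⊥-elim (fromℕ≢inject₁ (trans (sym q≡last) q≡b))
      same-target (closing a refl _ closes-a) (closing a′ refl _ closes-a′) =
        cong inject₁ (Maybe.just-injective (trans (sym closes-a) closes-a′))

  extend-nonNesting : NonNesting3 d → CanClose d closes → NonNesting3 e
  extend-nonNesting (no-nest , no-future) can-close = no-nest′ , no-future′
    where
    ↓ = inject₁-cancel-<
    no-nest′ : ¬ Nest3 e
    no-nest′ (i₁ , i₂ , i₃ , j₃ , j₂ , j₁ , h₁ , h₂ , h₃ , i₁<i₂ , i₂<i₃ , i₃<j₃ , j₃<j₂ , j₂<j₁)
      with arcView i₁ j₁ h₁ | arcView i₂ j₂ h₂ | arcView i₃ j₃ h₃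
    ... | _ | closing _ _ refl _ | _ = fromℕ-maximal j₁ j₂<j₁
    ... | _ | kept _ _ _ _ _ _ | closing _ _ refl _ = fromℕ-maximal j₂ j₃<j₂
    ... | kept a₁ b₁ refl refl a₁→b₁ _ | kept a₂ b₂ refl refl a₂→b₂ _ | kept a₃ b₃ refl refl a₃→b₃ _ =
      no-nest (a₁ , a₂ , a₃ , b₃ , b₂ , b₁ , a₁→b₁ , a₂→b₂ , a₃→b₃ , ↓ i₁<i₂ , ↓ i₂<i₃ , ↓ i₃<j₃ , ↓ j₃<j₂ , ↓ j₂<j₁)
    ... | closing a₁ refl _ refl | kept a₂ b₂ refl refl a₂→b₂ _ | kept a₃ b₃ refl refl a₃→b₃ _ =
      no-future (a₁ , a₂ , a₃ , b₃ , b₂ , proj₁ can-close , a₂→b₂ , a₃→b₃ , ↓ i₁<i₂ , ↓ i₂<i₃ , ↓ i₃<j₃ , ↓ j₃<j₂)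
    no-future′ : ¬ FutureNest3 e
    no-future′ (i₁ , i₂ , i₃ , j₃ , j₂ , s₁ , h₂ , h₃ , i₁<i₂ , i₂<i₃ , i₃<j₃ , j₃<j₂)
      with semiView i₁ s₁ | arcView i₂ j₂ h₂ | arcView i₃ j₃ h₃
    ... | opened refl | _ | _ = fromℕ-maximal i₂ i₁<i₂
    ... | kept _ _ _ _ | _ | closing _ _ refl _ = fromℕ-maximal j₂ j₃<j₂
    ... | kept s refl s-semi _ | kept a₂ b₂ refl refl a₂→b₂ _ | kept a₃ b₃ refl refl a₃→b₃ _ =
      no-future (s , a₂ , a₃ , b₃ , b₂ , s-semi , a₂→b₂ , a₃→b₃ , ↓ i₁<i₂ , ↓ i₂<i₃ , ↓ i₃<j₃ , ↓ j₃<j₂)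
    ... | kept s refl s-semi _ | closing a₂ refl _ refl | kept a₃ b₃ refl refl a₃→b₃ _ =
      proj₂ can-close (s , a₃ , b₃ , s-semi , ↓ i₁<i₂ , a₃→b₃ , ↓ i₂<i₃)

  extend-valid : Valid d → CanClose d closes → Valid e
  extend-valid (diagram , nonNesting) can-close = extend-isDiagram diagram , extend-nonNesting nonNesting can-close

  restrict-extend : CanClose d closes → restrict e ≡ (d , opens , closes)
  restrict-extend can-close = cong₂ _,_ restricted (cong₂ _,_ last-semi (restored-closer closes refl))
    where
    entry : ∀ a → restrictOut (extendAt d (opens , closes) (just a)) ≡ lookup d a
    entry a with closes ≟M just a
    ... | yes refl = trans (restrictOut-last n) (sym (proj₁ can-close))
    ... | no _ = restrictOut-extendOut (lookup d a)
    restricted : tabulate (λ a → restrictOut (lookup e (inject₁ a))) ≡ d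
    restricted = trans (Vec.tabulate-cong (λ a → trans (cong restrictOut (lookup-inject₁ a)) (entry a))) (Vec.tabulate∘lookup d)
    last-semi : isSemi (lookup e (fromℕ n)) ≡ opens
    last-semi = trans (cong isSemi lookup-fromℕ) (isSemi-lastOut opens)
    restored-closer : ∀ m → closes ≡ m → closer e ≡ m
    restored-closer nothing refl = closer-nothing e (λ a a→last → not-closing (arcView (inject₁ a) _ a→last))
      where
      not-closing : ∀ {a} → ArcView (inject₁ a) (fromℕ n) → ⊥
      not-closing (kept _ _ _ last≡b _ _) = fromℕ≢inject₁ last≡b
      not-closing (closing _ _ _ ())
    restored-closer (just a) refl = closer-just e (arc-closing refl) (λ b b→last → only-a (arcView (inject₁ b) _ b→last))
      where
      only-a : ∀ {b} → ArcView (inject₁ b) (fromℕ n) → b ≡ a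
      only-a (kept _ _ _ last≡b _ _) = ⊥-elim (fromℕ≢inject₁ last≡b)
      only-a (closing _ b≡a _ refl) = inject₁-injective b≡a

module Restrict {n : ℕ} (e : Code (suc n)) where

  d : Code n
  d = proj₁ (restrict e)

  closes : Maybe (Fin n)
  closes = closer e

  lookup-d : ∀ a → lookup d a ≡ restrictOut (lookup e (inject₁ a))
  lookup-d = Vec.lookup∘tabulate (λ a → restrictOut (lookup e (inject₁ a)))

  arc-lift : ∀ {a b} → IsArc d a b → IsArc e (inject₁ a) (inject₁ b)
  arc-lift {a} a→b = restrictOut≡arc _ (trans (sym (lookup-d a)) a→b)

  semi-lift : ∀ {s} → IsSemi d s → IsSemi e (inject₁ s) ⊎ IsArc e (inject₁ s) (fromℕ n)
  semi-lift {s} s-semi = restrictOut≡semi _ (trans (sym (lookup-d s)) s-semi)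

  closing-semi : ∀ {s} → IsArc e (inject₁ s) (fromℕ n) → IsSemi d s
  closing-semi {s} s→last = trans (lookup-d s) (trans (cong restrictOut s→last) (restrictOut-last n))

  restrict-valid : Valid e → Valid d × CanClose d closes
  restrict-valid ((forward , injective) , (no-nest , no-future)) =
    ((forward′ , injective′) , (no-nest′ , no-future′)) , can-close closes refl
    where
    ↑ = inject₁-mono-<
    forward′ : ∀ a b → IsArc d a b → a < b
    forward′ a b a→b = inject₁-cancel-< (forward _ _ (arc-lift a→b))
    injective′ : ∀ a a′ b → IsArc d a b → IsArc d a′ b → a ≡ a′
    injective′ a a′ b a→b a′→b = inject₁-injective (injective _ _ _ (arc-lift a→b) (arc-lift a′→b))
    no-nest′ : ¬ Nest3 d
    no-nest′ (_ , _ , _ , _ , _ , _ , h₁ , h₂ , h₃ , i₁<i₂ , i₂<i₃ , i₃<j₃ , j₃<j₂ , j₂<j₁) =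
      no-nest (_ , _ , _ , _ , _ , _ , arc-lift h₁ , arc-lift h₂ , arc-lift h₃ , ↑ i₁<i₂ , ↑ i₂<i₃ , ↑ i₃<j₃ , ↑ j₃<j₂ , ↑ j₂<j₁)
    no-future′ : ¬ FutureNest3 d
    no-future′ (_ , _ , _ , _ , j₂ , s₁ , h₂ , h₃ , i₁<i₂ , i₂<i₃ , i₃<j₃ , j₃<j₂) with semi-lift s₁
    ... | inj₁ s₁′ =
      no-future (_ , _ , _ , _ , _ , s₁′ , arc-lift h₂ , arc-lift h₃ , ↑ i₁<i₂ , ↑ i₂<i₃ , ↑ i₃<j₃ , ↑ j₃<j₂)
    ... | inj₂ s₁→last =
      no-nest (_ , _ , _ , _ , _ , _ , s₁→last , arc-lift h₂ , arc-lift h₃ , ↑ i₁<i₂ , ↑ i₂<i₃ , ↑ i₃<j₃ , ↑ j₃<j₂ , inject₁<fromℕ j₂)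
    can-close : ∀ m → closes ≡ m → CanClose d m
    can-close nothing _ = tt
    can-close (just a) closes-a = closing-semi a→last , not-blocked
      where
      a→last = closer-sound e closes-a
      not-blocked : ¬ Blocked d a
      not-blocked (s , p , q , s-semi , s<a , p→q , a<p) with semi-lift s-semi
      ... | inj₁ s-semi′ =
        no-future (_ , _ , _ , _ , _ , s-semi′ , a→last , arc-lift p→q , ↑ s<a , ↑ a<p , forward _ _ (arc-lift p→q) , inject₁<fromℕ q)
      ... | inj₂ s→last = ℕₚ.<-irrefl (cong toℕ (inject₁-injective (injective _ _ _ s→last a→last))) s<a

  extend-restrict : IsDiagram e → extend (restrict e) ≡ e
  extend-restrict (forward , injective) = trans (Vec.tabulate-cong entry) (Vec.tabulate∘lookup e)
    where
    entry : ∀ p → extendAt d (restrict e .proj₂) (toInit p) ≡ lookup e p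
    entry p with initLast p
    ... | initial a rewrite toInit-inject₁ a = old-vertex
      where
      old-vertex : extendAt d (restrict e .proj₂) (just a) ≡ lookup e (inject₁ a)
      old-vertex with closes ≟M just a
      ... | yes closes-a = sym (closer-sound e closes-a)
      ... | no ¬closes-a = trans (cong extendOut (lookup-d a)) (extendOut-restrictOut _ not-closing)
        where
        not-closing : lookup e (inject₁ a) ≢ arc (fromℕ n)
        not-closing a→last = ¬closes-a (closer-just e a→last (λ b b→last → inject₁-injective (injective _ _ _ b→last a→last)))
    ... | last rewrite toInit-fromℕ n = lastOut-isSemi (lookup e (fromℕ n)) (λ q last→q → fromℕ-maximal q (forward _ _ last→q))

inRange : ℕ → ℕ → ℕ → ℕ
inRange lo hi J = ⟦ lo ≤? J ⟧ * ⟦ J <? hi ⟧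

inRange-empty : ∀ x J → inRange x x J ≡ 0
inRange-empty x J with x ≤? J
... | yes x≤J = *-⟦⟧-no ⟦ x ≤? J ⟧ (J <? x) (ℕₚ.≤⇒≯ x≤J)
... | no x≰J = cong (_* ⟦ J <? x ⟧) (⟦⟧-no (x ≤? J) x≰J)

inRange-extendˡ : ∀ c h J → c ℕ.< h → ⟦ c ≟ J ⟧ + inRange (suc c) h J ≡ inRange c h J
inRange-extendˡ c h J c<h with c ≟ J
... | yes refl = trans (cong₂ (λ x y → x + y * ⟦ c <? h ⟧) (⟦⟧-yes (c ≟ c) refl) (⟦⟧-no (suc c ≤? c) (ℕₚ.<-irrefl refl)))
                       (sym (cong₂ _*_ (⟦⟧-yes (c ≤? c) ℕₚ.≤-refl) (⟦⟧-yes (c <? h) c<h)))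
... | no c≢J = cong₂ (λ x y → x + y * ⟦ J <? h ⟧) (⟦⟧-no (c ≟ J) c≢J)
                    (⟦⟧-cong (suc c ≤? J) (c ≤? J) ℕₚ.<⇒≤ (λ c≤J → ℕₚ.≤∧≢⇒< c≤J c≢J))

DownwardClosed : ∀ {n} → Pred (Fin n) 0ℓ → Set
DownwardClosed {n} A = ∀ (s a : Fin n) → s < a → A a → A s

size : ∀ {n} {S : Pred (Fin n) 0ℓ} → Decidable S → ℕ
size {n} S? = ∑[ s < n ] ⟦ S? s ⟧

size∩ : ∀ {n} {S A : Pred (Fin n) 0ℓ} → Decidable S → Decidable A → ℕ
size∩ {n} S? A? = ∑[ s < n ] (⟦ S? s ⟧ * ⟦ A? s ⟧)

rank : ∀ {n} {S : Pred (Fin n) 0ℓ} → Decidable S → Fin n → ℕ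
rank {n} S? a = ∑[ s < n ] (⟦ S? s ⟧ * ⟦ s Fin.<? a ⟧)

module _ {m : ℕ} {S : Pred (Fin (suc m)) 0ℓ} (S? : Decidable S) where

  rank-zero : rank S? zero ≡ 0
  rank-zero = ∑-zero (suc m) (λ s → *-⟦⟧-no ⟦ S? s ⟧ (s Fin.<? zero {n = m}) λ ())

  rank-suc : ∀ a → rank S? (suc a) ≡ ⟦ S? zero ⟧ + rank (λ i → S? (suc i)) a
  rank-suc a = cong₂ _+_ (*-⟦⟧-yes ⟦ S? zero ⟧ (zero {n = m} Fin.<? suc a) (s≤s z≤n))
    (sum-cong-≗ {m} (λ s → cong (⟦ S? (suc s) ⟧ *_) (⟦⟧-cong (suc s Fin.<? suc a) (s Fin.<? a) ℕ.s<s⁻¹ s≤s)))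

size∩-tail : ∀ {m} {S A : Pred (Fin (suc m)) 0ℓ} (S? : Decidable S) (A? : Decidable A) → DownwardClosed A → ¬ A zero →
  size∩ (λ i → S? (suc i)) (λ i → A? (suc i)) ≡ 0
size∩-tail {m} S? A? closed ¬A₀ =
  ∑-zero m (λ s → *-⟦⟧-no ⟦ S? (suc s) ⟧ (A? (suc s)) (λ As → ¬A₀ (closed zero (suc s) (s≤s z≤n) As)))

∑-rank-peel : ∀ {m} {S : Pred (Fin (suc m)) 0ℓ} (S? : Decidable S) (h : Fin (suc m) → ℕ → ℕ) c →
  ∑[ a < suc m ] h a (c + rank S? a) ≡ h zero c + ∑[ a < m ] h (suc a) (c + ⟦ S? zero ⟧ + rank (λ i → S? (suc i)) a)
∑-rank-peel {m} S? h c = cong₂ _+_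
  (cong (h zero) (trans (cong (c +_) (rank-zero S?)) (ℕₚ.+-identityʳ c)))
  (sum-cong-≗ {m} (λ a → cong (h (suc a)) (trans (cong (c +_) (rank-suc S? a)) (sym (ℕₚ.+-assoc c _ _)))))

inRange-cons : ∀ {S₀ A₀ : Set} (S₀? : Dec S₀) (A₀? : Dec A₀) c J x y → (¬ A₀ → x ≡ 0) →
  ⟦ S₀? ⟧ * (⟦ ¬? A₀? ⟧ * ⟦ c ≟ J ⟧) + inRange (c + ⟦ S₀? ⟧ + x) (c + ⟦ S₀? ⟧ + y) J ≡
  inRange (c + (⟦ S₀? ⟧ * ⟦ A₀? ⟧ + x)) (c + (⟦ S₀? ⟧ + y)) J
inRange-cons (no _) A₀? c J x y _ = cong (λ c′ → inRange (c′ + x) (c′ + y) J) (ℕₚ.+-identityʳ c)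
inRange-cons (yes _) (yes _) c J x y _ = cong₂ (λ l h → inRange l h J) (ℕₚ.+-assoc c 1 x) (ℕₚ.+-assoc c 1 y)
inRange-cons (yes _) (no ¬A₀) c J x y x≡0 rewrite x≡0 ¬A₀ = begin
  1 * (1 * ⟦ c ≟ J ⟧) + inRange (c + 1 + 0) (c + 1 + y) J
    ≡⟨ cong₂ _+_ (trans (ℕₚ.*-identityˡ _) (ℕₚ.*-identityˡ _))
                 (cong₂ (λ l h → inRange l h J) (trans (ℕₚ.+-identityʳ (c + 1)) (ℕₚ.+-comm c 1)) (ℕₚ.+-assoc c 1 y)) ⟩
  ⟦ c ≟ J ⟧ + inRange (suc c) (c + suc y) J
    ≡⟨ inRange-extendˡ c (c + suc y) J (ℕₚ.m<m+n c (s≤s z≤n)) ⟩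
  inRange c (c + suc y) J
    ≡⟨ cong (λ l → inRange l (c + suc y) J) (ℕₚ.+-identityʳ c) ⟨
  inRange (c + 0) (c + (1 + y)) J ∎
  where open ≡-Reasoning

∑-rank-unflagged : ∀ n {S A : Pred (Fin n) 0ℓ} (S? : Decidable S) (A? : Decidable A) → DownwardClosed A → ∀ c J →
  ∑[ a < n ] (⟦ S? a ⟧ * (⟦ ¬? (A? a) ⟧ * ⟦ c + rank S? a ≟ J ⟧)) ≡ inRange (c + size∩ S? A?) (c + size S?) J
∑-rank-unflagged zero S? A? closed c J = sym (inRange-empty (c + 0) J)
∑-rank-unflagged (suc m) S? A? closed c J =
  trans (∑-rank-peel S? (λ a r → ⟦ S? a ⟧ * (⟦ ¬? (A? a) ⟧ * ⟦ r ≟ J ⟧)) c)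
  (trans (cong (⟦ S? zero ⟧ * (⟦ ¬? (A? zero) ⟧ * ⟦ c ≟ J ⟧) +_)
               (∑-rank-unflagged m (λ i → S? (suc i)) (λ i → A? (suc i)) (λ s a s<a → closed (suc s) (suc a) (s≤s s<a)) (c + ⟦ S? zero ⟧) J))
         (inRange-cons (S? zero) (A? zero) c J _ _ (size∩-tail S? A? closed)))

flagged-cons : ∀ {S₀ A₀ : Set} (S₀? : Dec S₀) (A₀? : Dec A₀) c x → (¬ A₀ → x ≡ 0) →
  ⟦ S₀? ⟧ * (⟦ A₀? ⟧ * ⟦ c ≟ 0 ⟧) + ⟦ c + ⟦ S₀? ⟧ ≟ 0 ⟧ * ⟦ 1 ≤? x ⟧ ≡ ⟦ c ≟ 0 ⟧ * ⟦ 1 ≤? ⟦ S₀? ⟧ * ⟦ A₀? ⟧ + x ⟧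
flagged-cons (no _) A₀? c x _ = cong (λ c′ → ⟦ c′ ≟ 0 ⟧ * ⟦ 1 ≤? x ⟧) (ℕₚ.+-identityʳ c)
flagged-cons (yes _) (yes _) c x _ = begin
  1 * (1 * ⟦ c ≟ 0 ⟧) + ⟦ c + 1 ≟ 0 ⟧ * ⟦ 1 ≤? x ⟧
    ≡⟨ cong₂ _+_ (trans (ℕₚ.*-identityˡ _) (ℕₚ.*-identityˡ _)) (cong (_* ⟦ 1 ≤? x ⟧) (⟦⟧-no (c + 1 ≟ 0) (ℕₚ.m+1+n≢0 c))) ⟩
  ⟦ c ≟ 0 ⟧ + 0
    ≡⟨ ℕₚ.+-identityʳ ⟦ c ≟ 0 ⟧ ⟩
  ⟦ c ≟ 0 ⟧
    ≡⟨ *-⟦⟧-yes ⟦ c ≟ 0 ⟧ (1 ≤? suc x) (s≤s z≤n) ⟨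
  ⟦ c ≟ 0 ⟧ * ⟦ 1 ≤? suc x ⟧ ∎
  where open ≡-Reasoning
flagged-cons (yes _) (no ¬A₀) c x x≡0 rewrite x≡0 ¬A₀ =
  trans (ℕₚ.*-zeroʳ ⟦ c + 1 ≟ 0 ⟧) (sym (ℕₚ.*-zeroʳ ⟦ c ≟ 0 ⟧))

∑-rank-flagged : ∀ n {S A : Pred (Fin n) 0ℓ} (S? : Decidable S) (A? : Decidable A) → DownwardClosed A → ∀ c →
  ∑[ a < n ] (⟦ S? a ⟧ * (⟦ A? a ⟧ * ⟦ c + rank S? a ≟ 0 ⟧)) ≡ ⟦ c ≟ 0 ⟧ * ⟦ 1 ≤? size∩ S? A? ⟧
∑-rank-flagged zero S? A? closed c = sym (ℕₚ.*-zeroʳ ⟦ c ≟ 0 ⟧)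
∑-rank-flagged (suc m) S? A? closed c =
  trans (∑-rank-peel S? (λ a r → ⟦ S? a ⟧ * (⟦ A? a ⟧ * ⟦ r ≟ 0 ⟧)) c)
  (trans (cong (⟦ S? zero ⟧ * (⟦ A? zero ⟧ * ⟦ c ≟ 0 ⟧) +_)
               (∑-rank-flagged m (λ i → S? (suc i)) (λ i → A? (suc i)) (λ s a s<a → closed (suc s) (suc a) (s≤s s<a)) (c + ⟦ S? zero ⟧)))
         (flagged-cons (S? zero) (A? zero) c _ (size∩-tail S? A? closed)))

-- S plays the semi-arcs and A those with an arc starting to their right; once a is
-- removed, a remaining s lies in a future 2-nesting iff A s or s < a.
module Removal {n : ℕ} {S A : Pred (Fin n) 0ℓ} (S? : Decidable S) (A? : Decidable A) (closed : DownwardClosed A) where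

  flaggedAfterRemoving : Fin n → ℕ
  flaggedAfterRemoving a = ∑[ s < n ] (⟦ S? s ⟧ * (⟦ ¬? (s Fin.≟ a) ⟧ * ⟦ A? s ⊎-dec s Fin.<? a ⟧))

  flaggedAfterRemoving-unflagged : ∀ a → ¬ A a → flaggedAfterRemoving a ≡ rank S? a
  flaggedAfterRemoving-unflagged a ¬Aa = sum-cong-≗ {n} (λ s → cong (⟦ S? s ⟧ *_) (flag s))
    where
    flag : ∀ s → ⟦ ¬? (s Fin.≟ a) ⟧ * ⟦ A? s ⊎-dec s Fin.<? a ⟧ ≡ ⟦ s Fin.<? a ⟧
    flag s with s Fin.≟ a | Fin.<-cmp s a
    ... | yes refl | _ = sym (⟦⟧-no (s Fin.<? s) (Fin.<-irrefl refl))
    ... | no _ | tri< s<a _ _ = trans (ℕₚ.*-identityˡ _) (⟦⟧-cong (A? s ⊎-dec s Fin.<? a) (s Fin.<? a) (λ _ → s<a) inj₂)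
    ... | no s≢a | tri≈ _ s≡a _ = ⊥-elim (s≢a s≡a)
    ... | no _ | tri> _ _ a<s = trans (ℕₚ.*-identityˡ _) (⟦⟧-cong (A? s ⊎-dec s Fin.<? a) (s Fin.<? a) below inj₂)
      where
      below : A s ⊎ s < a → s < a
      below (inj₁ As) = ⊥-elim (¬Aa (closed a s a<s As))
      below (inj₂ s<a) = s<a

  flaggedAfterRemoving-least : ∀ a → S a → A a → (∀ s → S s → ¬ s < a) → flaggedAfterRemoving a + 1 ≡ size∩ S? A?
  flaggedAfterRemoving-least a Sa Aa least = begin
    flaggedAfterRemoving a + 1                                  ≡⟨ cong (_+ 1) (sum-cong-≗ {n} flag) ⟩
    ∑[ s < n ] (⟦ S? s ×-dec A? s ⟧ * ⟦ ¬? (s Fin.≟ a) ⟧) + 1  ≡⟨ ∑-remove n (λ s → S? s ×-dec A? s) a (Sa , Aa) ⟩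
    ∑[ s < n ] ⟦ S? s ×-dec A? s ⟧                             ≡⟨ sum-cong-≗ {n} (λ s → ⟦⟧-× (S? s) (A? s)) ⟩
    size∩ S? A?                                                ∎
    where
    open ≡-Reasoning
    flag : ∀ s → ⟦ S? s ⟧ * (⟦ ¬? (s Fin.≟ a) ⟧ * ⟦ A? s ⊎-dec s Fin.<? a ⟧) ≡ ⟦ S? s ×-dec A? s ⟧ * ⟦ ¬? (s Fin.≟ a) ⟧
    flag s with S? s
    ... | no _ = refl
    ... | yes Ss = trans (ℕₚ.+-identityʳ _)
                   (trans (cong (⟦ ¬? (s Fin.≟ a) ⟧ *_) (⟦⟧-cong (A? s ⊎-dec s Fin.<? a) (A? s) flagged inj₁))
                          (ℕₚ.*-comm ⟦ ¬? (s Fin.≟ a) ⟧ ⟦ A? s ⟧))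
      where
      flagged : A s ⊎ s < a → A s
      flagged (inj₁ As) = As
      flagged (inj₂ s<a) = ⊥-elim (least s Ss s<a)

  rank≡0⇒least : ∀ a → rank S? a ≡ 0 → ∀ s → S s → ¬ s < a
  rank≡0⇒least a rank≡0 s Ss s<a = ℕₚ.1+n≢0 (trans
    (sym (cong₂ _*_ (⟦⟧-yes (S? s) Ss) (⟦⟧-yes (s Fin.<? a) s<a)))
    (∑-zero⇒ n (λ s → ⟦ S? s ⟧ * ⟦ s Fin.<? a ⟧) rank≡0 s))

  rank≢0⇒below : ∀ a → rank S? a ≢ 0 → ∃[ s ] (S s × s < a)
  rank≢0⇒below a rank≢0 with ∑-nonzero⇒ n (λ s → ⟦ S? s ⟧ * ⟦ s Fin.<? a ⟧) rank≢0
  ... | s , term≢0 with S? s | s Fin.<? a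
  ...   | yes Ss | yes s<a = s , Ss , s<a
  ...   | yes _ | no s≮a = ⊥-elim (term≢0 (cong (1 *_) (⟦⟧-no (s Fin.<? a) s≮a)))
  ...   | no _ | _ = ⊥-elim (term≢0 refl)

  module _ {R : Pred (Fin n) 0ℓ} (R? : Decidable R)
    (R⇒ : ∀ a → R a → S a × ¬ ((∃[ s ] (S s × s < a)) × A a))
    (⇒R : ∀ a → S a → ¬ ((∃[ s ] (S s × s < a)) × A a) → R a) where

    private
      Φ = size∩ S? A?

    count-by-rank : ∀ J a → ⟦ R? a ⟧ * ⟦ flaggedAfterRemoving a ≟ J ⟧ ≡
      ⟦ S? a ⟧ * (⟦ ¬? (A? a) ⟧ * ⟦ rank S? a ≟ J ⟧) + ⟦ S? a ⟧ * (⟦ A? a ⟧ * ⟦ rank S? a ≟ 0 ⟧) * ⟦ Φ ≟ suc J ⟧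
    count-by-rank J a with S? a
    ... | no ¬Sa = cong (_* _) (⟦⟧-no (R? a) (λ Ra → ¬Sa (proj₁ (R⇒ a Ra))))
    ... | yes Sa with A? a
    ...   | no ¬Aa = begin
      ⟦ R? a ⟧ * ⟦ flaggedAfterRemoving a ≟ J ⟧ ≡⟨ cong₂ _*_ (⟦⟧-yes (R? a) (⇒R a Sa (λ (_ , Aa) → ¬Aa Aa)))
                                                            (cong (λ x → ⟦ x ≟ J ⟧) (flaggedAfterRemoving-unflagged a ¬Aa)) ⟩
      1 * ⟦ rank S? a ≟ J ⟧                    ≡⟨ ℕₚ.*-identityˡ _ ⟩
      ⟦ rank S? a ≟ J ⟧                        ≡⟨ trans (ℕₚ.+-identityʳ _) (trans (ℕₚ.*-identityˡ _) (ℕₚ.*-identityˡ _)) ⟨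
      1 * (1 * ⟦ rank S? a ≟ J ⟧) + 0          ∎
      where open ≡-Reasoning
    ...   | yes Aa with rank S? a ≟ 0
    ...     | yes rank≡0 = begin
      ⟦ R? a ⟧ * ⟦ flaggedAfterRemoving a ≟ J ⟧ ≡⟨ cong₂ _*_ (⟦⟧-yes (R? a) (⇒R a Sa (λ ((s , Ss , s<a) , _) → least s Ss s<a)))
                                                            (⟦⟧-cong (flaggedAfterRemoving a ≟ J) (Φ ≟ suc J) to from) ⟩
      1 * ⟦ Φ ≟ suc J ⟧                        ≡⟨ cong (λ x → 1 * (1 * x) * ⟦ Φ ≟ suc J ⟧) (⟦⟧-yes (rank S? a ≟ 0) rank≡0) ⟨
      1 * (1 * ⟦ rank S? a ≟ 0 ⟧) * ⟦ Φ ≟ suc J ⟧ ∎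
      where
      open ≡-Reasoning
      least = rank≡0⇒least a rank≡0
      removed = flaggedAfterRemoving-least a Sa Aa least
      to : flaggedAfterRemoving a ≡ J → Φ ≡ suc J
      to refl = trans (sym removed) (ℕₚ.+-comm _ 1)
      from : Φ ≡ suc J → flaggedAfterRemoving a ≡ J
      from Φ≡1+J = ℕₚ.suc-injective (trans (ℕₚ.+-comm 1 _) (trans removed Φ≡1+J))
    ...     | no rank≢0 = begin
      ⟦ R? a ⟧ * ⟦ flaggedAfterRemoving a ≟ J ⟧ ≡⟨ cong (_* _) (⟦⟧-no (R? a) (λ Ra → proj₂ (R⇒ a Ra) (rank≢0⇒below a rank≢0 , Aa))) ⟩
      0                                        ≡⟨ cong (λ x → 1 * (1 * x) * ⟦ Φ ≟ suc J ⟧) (⟦⟧-no (rank S? a ≟ 0) rank≢0) ⟨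
      1 * (1 * ⟦ rank S? a ≟ 0 ⟧) * ⟦ Φ ≟ suc J ⟧ ∎
      where open ≡-Reasoning

    count-removals : ∀ J → ∑[ a < n ] (⟦ R? a ⟧ * ⟦ flaggedAfterRemoving a ≟ J ⟧) ≡ inRange Φ (size S?) J + ⟦ Φ ≟ suc J ⟧
    count-removals J = begin
      ∑[ a < n ] (⟦ R? a ⟧ * ⟦ flaggedAfterRemoving a ≟ J ⟧)
        ≡⟨ sum-cong-≗ {n} (count-by-rank J) ⟩
      ∑[ a < n ] (unflagged a + flagged a * ⟦ Φ ≟ suc J ⟧)
        ≡⟨ ∑-distrib-+ unflagged (λ a → flagged a * ⟦ Φ ≟ suc J ⟧) ⟩
      ∑[ a < n ] unflagged a + ∑[ a < n ] (flagged a * ⟦ Φ ≟ suc J ⟧)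
        ≡⟨ cong₂ _+_ (∑-rank-unflagged n S? A? closed 0 J) (sym (*-distribʳ-sum ⟦ Φ ≟ suc J ⟧ flagged)) ⟩
      inRange Φ (size S?) J + ∑[ a < n ] flagged a * ⟦ Φ ≟ suc J ⟧
        ≡⟨ cong (λ x → inRange Φ (size S?) J + x * ⟦ Φ ≟ suc J ⟧) (∑-rank-flagged n S? A? closed 0) ⟩
      inRange Φ (size S?) J + 1 * ⟦ 1 ≤? Φ ⟧ * ⟦ Φ ≟ suc J ⟧
        ≡⟨ cong (inRange Φ (size S?) J +_) (nonempty Φ) ⟩
      inRange Φ (size S?) J + ⟦ Φ ≟ suc J ⟧ ∎
      where
      open ≡-Reasoning
      unflagged flagged : Fin n → ℕ
      unflagged a = ⟦ S? a ⟧ * (⟦ ¬? (A? a) ⟧ * ⟦ rank S? a ≟ J ⟧)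
      flagged a = ⟦ S? a ⟧ * (⟦ A? a ⟧ * ⟦ rank S? a ≟ 0 ⟧)
      nonempty : ∀ x → 1 * ⟦ 1 ≤? x ⟧ * ⟦ x ≟ suc J ⟧ ≡ ⟦ x ≟ suc J ⟧
      nonempty x with x ≟ suc J
      ... | yes refl = trans (cong (λ u → 1 * u * ⟦ suc J ≟ suc J ⟧) (⟦⟧-yes (1 ≤? suc J) (s≤s z≤n))) (ℕₚ.*-identityˡ _)
      ... | no x≢1+J = trans (cong (1 * ⟦ 1 ≤? x ⟧ *_) (⟦⟧-no (x ≟ suc J) x≢1+J))
                             (trans (ℕₚ.*-zeroʳ (1 * ⟦ 1 ≤? x ⟧)) (sym (⟦⟧-no (x ≟ suc J) x≢1+J)))

Blocked? : ∀ {n} (d : Code n) → Decidable (Blocked d)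
Blocked? d a = any? λ s → any? λ p → any? λ q → IsSemi? d s ×-dec s Fin.<? a ×-dec IsArc? d p q ×-dec a Fin.<? p

CanClose? : ∀ {n} (d : Code n) → Decidable (CanClose d)
CanClose? d nothing = yes tt
CanClose? d (just a) = IsSemi? d a ×-dec ¬? (Blocked? d a)

Valid? : ∀ {n} → Decidable (Valid {n})
Valid? d = IsDiagram? d ×-dec NonNesting3? d

ArcAfter : ∀ {n} → Code n → Fin n → Set
ArcAfter d s = ∃[ p ] ∃[ q ] (IsArc d p q × s < p)

ArcAfter? : ∀ {n} (d : Code n) → Decidable (ArcAfter d)
ArcAfter? d s = any? λ p → any? λ q → IsArc? d p q ×-dec s Fin.<? p

arcAfter-downwardClosed : ∀ {n} (d : Code n) → DownwardClosed (ArcAfter d)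
arcAfter-downwardClosed d s a s<a (p , q , p→q , a<p) = p , q , p→q , Fin.<-trans s<a a<p

semiArcs≡size : ∀ {n} (d : Code n) → semiArcs d ≡ size (IsSemi? d)
semiArcs≡size {n} d = trans (length-filter (IsSemi? d) (allFin n)) (∑ˡ-allFin n _)

futureSemiArcs≡∑ : ∀ {n} (d : Code n) → futureSemiArcs d ≡ ∑[ s < n ] ⟦ InFutureNest2? d s ⟧
futureSemiArcs≡∑ {n} d = trans (length-filter (InFutureNest2? d) (allFin n)) (∑ˡ-allFin n _)

futureSemiArcs≡size∩ : ∀ {n} (d : Code n) → futureSemiArcs d ≡ size∩ (IsSemi? d) (ArcAfter? d)
futureSemiArcs≡size∩ {n} d = trans (futureSemiArcs≡∑ d) (sum-cong-≗ {n} (λ s → ⟦⟧-× (IsSemi? d s) (ArcAfter? d s)))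

bit : Bool → ℕ
bit true = 1
bit false = 0

module ExtensionStatistics {n : ℕ} (d : Code n) (opens : Bool) (closes : Maybe (Fin n)) where
  open Extend d opens closes

  semiArcs-extend : semiArcs e ≡ ∑[ a < n ] ⟦ IsSemi? e (inject₁ a) ⟧ + bit opens
  semiArcs-extend = trans (semiArcs≡size e) (trans (sum-init-last (λ p → ⟦ IsSemi? e p ⟧))
    (cong (∑[ a < n ] ⟦ IsSemi? e (inject₁ a) ⟧ +_) (last-vertex opens lookup-fromℕ)))
    where
    last-vertex : ∀ b → lookup e (fromℕ n) ≡ lastOut b → ⟦ IsSemi? e (fromℕ n) ⟧ ≡ bit b
    last-vertex true last-semi = ⟦⟧-yes (IsSemi? e (fromℕ n)) last-semi
    last-vertex false last-none = ⟦⟧-no (IsSemi? e (fromℕ n)) (λ last-semi → none≢semi (trans (sym last-none) last-semi))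
      where
      none≢semi : ∀ {m} → Out.none {m} ≢ semi
      none≢semi ()

  futureSemiArcs-extend : futureSemiArcs e ≡ ∑[ a < n ] ⟦ InFutureNest2? e (inject₁ a) ⟧
  futureSemiArcs-extend = trans (futureSemiArcs≡∑ e) (trans (sum-init-last (λ p → ⟦ InFutureNest2? e p ⟧))
    (trans (cong (∑[ a < n ] ⟦ InFutureNest2? e (inject₁ a) ⟧ +_) (⟦⟧-no (InFutureNest2? e (fromℕ n)) last-free))
           (ℕₚ.+-identityʳ _)))
    where
    last-free : ¬ InFutureNest2 e (fromℕ n)
    last-free (_ , p , _ , _ , last<p) = fromℕ-maximal p last<p

module _ {n : ℕ} (d : Code n) (opens : Bool) where
  open Extend d opens nothing
  open ExtensionStatistics d opens nothing

  semiArcs-extend-open : semiArcs e ≡ semiArcs d + bit opens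
  semiArcs-extend-open = trans semiArcs-extend (cong (_+ bit opens) (trans (sum-cong-≗ {n} same) (sym (semiArcs≡size d))))
    where
    same : ∀ a → ⟦ IsSemi? e (inject₁ a) ⟧ ≡ ⟦ IsSemi? d a ⟧
    same a = ⟦⟧-cong (IsSemi? e (inject₁ a)) (IsSemi? d a) (λ a-semi → proj₁ (semi-inject₁ a a-semi)) (λ a-semi → semi-kept a-semi λ ())

  futureSemiArcs-extend-open : futureSemiArcs e ≡ futureSemiArcs d
  futureSemiArcs-extend-open = trans futureSemiArcs-extend
    (trans (sum-cong-≗ {n} same) (sym (futureSemiArcs≡∑ d)))
    where
    same : ∀ a → ⟦ InFutureNest2? e (inject₁ a) ⟧ ≡ ⟦ InFutureNest2? d a ⟧
    same a = ⟦⟧-cong (InFutureNest2? e (inject₁ a)) (InFutureNest2? d a) to from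
      where
      to : InFutureNest2 e (inject₁ a) → InFutureNest2 d a
      to (a-semi , p , q , p→q , a<p) with arcView p q p→q
      ... | kept a′ b′ refl _ a′→b′ _ = proj₁ (semi-inject₁ a a-semi) , a′ , b′ , a′→b′ , inject₁-cancel-< a<p
      from : InFutureNest2 d a → InFutureNest2 e (inject₁ a)
      from (a-semi , p , q , p→q , a<p) = semi-kept a-semi (λ ()) , inject₁ p , inject₁ q , arc-kept p→q (λ ()) , inject₁-mono-< a<p

module _ {n : ℕ} (d : Code n) (opens : Bool) (a : Fin n) (can-close : CanClose d (just a)) where
  open Extend d opens (just a)
  open ExtensionStatistics d opens (just a)
  open Removal (IsSemi? d) (ArcAfter? d) (arcAfter-downwardClosed d)

  private
    other : ∀ {s} → just a ≢ just s → s ≢ a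
    other a≢s refl = a≢s refl

    same : ∀ {s} → s ≢ a → just a ≢ just s
    same s≢a a≡s = s≢a (sym (Maybe.just-injective a≡s))

  semiArcs-extend-close : semiArcs e + 1 ≡ semiArcs d + bit opens
  semiArcs-extend-close = begin
    semiArcs e + 1                                                        ≡⟨ cong (_+ 1) semiArcs-extend ⟩
    ∑[ s < n ] ⟦ IsSemi? e (inject₁ s) ⟧ + bit opens + 1                  ≡⟨ ℕₚ.+-assoc _ (bit opens) 1 ⟩
    ∑[ s < n ] ⟦ IsSemi? e (inject₁ s) ⟧ + (bit opens + 1)                ≡⟨ cong₂ _+_ (sum-cong-≗ {n} remaining) (ℕₚ.+-comm (bit opens) 1) ⟩
    ∑[ s < n ] (⟦ IsSemi? d s ⟧ * ⟦ ¬? (s Fin.≟ a) ⟧) + (1 + bit opens)  ≡⟨ ℕₚ.+-assoc _ 1 (bit opens) ⟨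
    ∑[ s < n ] (⟦ IsSemi? d s ⟧ * ⟦ ¬? (s Fin.≟ a) ⟧) + 1 + bit opens    ≡⟨ cong (_+ bit opens) (∑-remove n (IsSemi? d) a (proj₁ can-close)) ⟩
    size (IsSemi? d) + bit opens                                          ≡⟨ cong (_+ bit opens) (semiArcs≡size d) ⟨
    semiArcs d + bit opens                                                ∎
    where
    open ≡-Reasoning
    remaining : ∀ s → ⟦ IsSemi? e (inject₁ s) ⟧ ≡ ⟦ IsSemi? d s ⟧ * ⟦ ¬? (s Fin.≟ a) ⟧
    remaining s = trans (⟦⟧-cong (IsSemi? e (inject₁ s)) (IsSemi? d s ×-dec ¬? (s Fin.≟ a))
        (λ s-semi → proj₁ (semi-inject₁ s s-semi) , other (proj₂ (semi-inject₁ s s-semi)))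
        (λ (s-semi , s≢a) → semi-kept s-semi (same s≢a)))
      (⟦⟧-× (IsSemi? d s) (¬? (s Fin.≟ a)))

  -- The new arc (a, n+1) puts every remaining semi-arc left of a into a future 2-nesting.
  futureSemiArcs-extend-close : futureSemiArcs e ≡ flaggedAfterRemoving a
  futureSemiArcs-extend-close = trans futureSemiArcs-extend (sum-cong-≗ {n} flagged)
    where
    flagged : ∀ s → ⟦ InFutureNest2? e (inject₁ s) ⟧ ≡ ⟦ IsSemi? d s ⟧ * (⟦ ¬? (s Fin.≟ a) ⟧ * ⟦ ArcAfter? d s ⊎-dec s Fin.<? a ⟧)
    flagged s = trans (⟦⟧-cong (InFutureNest2? e (inject₁ s)) (IsSemi? d s ×-dec ¬? (s Fin.≟ a) ×-dec (ArcAfter? d s ⊎-dec s Fin.<? a)) to from)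
      (trans (⟦⟧-× (IsSemi? d s) (¬? (s Fin.≟ a) ×-dec (ArcAfter? d s ⊎-dec s Fin.<? a)))
             (cong (⟦ IsSemi? d s ⟧ *_) (⟦⟧-× (¬? (s Fin.≟ a)) (ArcAfter? d s ⊎-dec s Fin.<? a))))
      where
      to : InFutureNest2 e (inject₁ s) → IsSemi d s × s ≢ a × (ArcAfter d s ⊎ s < a)
      to (s-semi , p , q , p→q , s<p) with semi-inject₁ s s-semi | arcView p q p→q
      ... | s-semi′ , a≢s | kept a′ b′ refl _ a′→b′ _ = s-semi′ , other a≢s , inj₁ (a′ , b′ , a′→b′ , inject₁-cancel-< s<p)
      ... | s-semi′ , a≢s | closing _ refl _ refl = s-semi′ , other a≢s , inj₂ (inject₁-cancel-< s<p)
      from : IsSemi d s × s ≢ a × (ArcAfter d s ⊎ s < a) → InFutureNest2 e (inject₁ s)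
      from (s-semi , s≢a , inj₁ (p , q , p→q , s<p)) =
        semi-kept s-semi (same s≢a) , inject₁ p , inject₁ q , arc-kept p→q not-closed , inject₁-mono-< s<p
        where
        not-closed : just a ≢ just p
        not-closed a≡p with refl ← Maybe.just-injective a≡p = semi≢arc (trans (sym (proj₁ can-close)) p→q)
          where
          semi≢arc : ∀ {m} {b : Fin m} → Out.semi ≢ arc b
          semi≢arc ()
      from (s-semi , s≢a , inj₂ s<a) = semi-kept s-semi (same s≢a) , inject₁ a , fromℕ n , arc-closing refl , inject₁-mono-< s<a

module _ (n I J : ℕ) where

  Counted : Code (suc n) → Set
  Counted e = IsDiagram e × NonNesting3 e × semiArcs e ≡ I × futureSemiArcs e ≡ J

  Counted? : Decidable Counted
  Counted? e = IsDiagram? e ×-dec NonNesting3? e ×-dec semiArcs e ≟ I ×-dec futureSemiArcs e ≟ J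

  CountedExtension : Extension n → Set
  CountedExtension (d , c) =
    Valid d × CanClose d (proj₂ c) × semiArcs (extend (d , c)) ≡ I × futureSemiArcs (extend (d , c)) ≡ J

  CountedExtension? : Decidable CountedExtension
  CountedExtension? (d , c) =
    Valid? d ×-dec CanClose? d (proj₂ c) ×-dec semiArcs (extend (d , c)) ≟ I ×-dec futureSemiArcs (extend (d , c)) ≟ J

  Acount-suc : Acount (suc n) I J ≡ ∑[ d ∈ allCodes n ] ∑[ c ∈ choices n ] ⟦ CountedExtension? (d , c) ⟧
  Acount-suc = begin
    Acount (suc n) I J                                  ≡⟨ length-filter Counted? (allCodes (suc n)) ⟩
    ∑[ e ∈ allCodes (suc n) ] ⟦ Counted? e ⟧           ≡⟨ count-bijection (allCodes-enumerates (suc n)) (extensions-enumerates n)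
                                                             Counted? CountedExtension? restrict extend to from extend∘restrict restrict∘extend ⟩
    ∑[ y ∈ extensions n ] ⟦ CountedExtension? y ⟧      ≡⟨ ∑ˡ-concatMap _ (allCodes n) _ ⟩
    ∑[ d ∈ allCodes n ] ∑ˡ (map (d ,_) (choices n)) (λ y → ⟦ CountedExtension? y ⟧)
                                                        ≡⟨ ∑ˡ-cong (allCodes n) (λ d → ∑ˡ-map (d ,_) (choices n) _) ⟩
    ∑[ d ∈ allCodes n ] ∑[ c ∈ choices n ] ⟦ CountedExtension? (d , c) ⟧ ∎
    where
    open ≡-Reasoning
    extend∘restrict : ∀ e → Counted e → extend (restrict e) ≡ e
    extend∘restrict e (diagram , _) = Restrict.extend-restrict e diagram
    restrict∘extend : ∀ y → CountedExtension y → restrict (extend y) ≡ y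
    restrict∘extend (d , opens , closes) (_ , can-close , _) = Extend.restrict-extend d opens closes can-close
    to : ∀ e → Counted e → CountedExtension (restrict e)
    to e (diagram , nonNesting , semis , futures) =
      valid , can-close , trans (cong semiArcs restored) semis , trans (cong futureSemiArcs restored) futures
      where
      restored = Restrict.extend-restrict e diagram
      valid = proj₁ (Restrict.restrict-valid e (diagram , nonNesting))
      can-close = proj₂ (Restrict.restrict-valid e (diagram , nonNesting))
    from : ∀ y → CountedExtension y → Counted (extend y)
    from (d , opens , closes) (valid , can-close , semis , futures) =
      proj₁ extended , proj₂ extended , semis , futures
      where extended = Extend.extend-valid d opens closes valid can-close

closings : ℕ → ℕ → ℕ → ℕ
closings i j J = inRange j i J + ⟦ j ≟ suc J ⟧

extensionCount : (I J i j : ℕ) → ℕ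
extensionCount I J i j = ∑[ b ∈ false ∷ true ∷ [] ] (⟦ i + bit b ≟ I ⟧ * ⟦ j ≟ J ⟧ + ⟦ i + bit b ≟ suc I ⟧ * closings i j J)

module _ {n : ℕ} (d : Code n) (I J : ℕ) where

  private
    i = semiArcs d
    j = futureSemiArcs d
    open Removal (IsSemi? d) (ArcAfter? d) (arcAfter-downwardClosed d)

    counted : Choice n → ℕ
    counted c = ⟦ CanClose? d (proj₂ c) ⟧ * (⟦ semiArcs (extend (d , c)) ≟ I ⟧ * ⟦ futureSemiArcs (extend (d , c)) ≟ J ⟧)

  closable-count : ∑[ a < n ] (⟦ CanClose? d (just a) ⟧ * ⟦ flaggedAfterRemoving a ≟ J ⟧) ≡ closings i j J
  closable-count = trans
    (count-removals (λ a → CanClose? d (just a))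
      (λ a (a-semi , unblocked) → a-semi , λ ((s , s-semi , s<a) , (p , q , p→q , a<p)) → unblocked (s , p , q , s-semi , s<a , p→q , a<p))
      (λ a a-semi unblocked → a-semi , λ (s , p , q , s-semi , s<a , p→q , a<p) → unblocked ((s , s-semi , s<a) , (p , q , p→q , a<p)))
      J)
    (cong₂ (λ x y → inRange x y J + ⟦ x ≟ suc J ⟧) (sym (futureSemiArcs≡size∩ d)) (sym (semiArcs≡size d)))

  counted-open : ∀ b → counted (b , nothing) ≡ ⟦ i + bit b ≟ I ⟧ * ⟦ j ≟ J ⟧
  counted-open b = trans (ℕₚ.*-identityˡ _)
    (cong₂ (λ x y → ⟦ x ≟ I ⟧ * ⟦ y ≟ J ⟧) (semiArcs-extend-open d b) (futureSemiArcs-extend-open d b))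

  counted-close : ∀ b a →
    ⟦ CanClose? d (just a) ⟧ * (⟦ semiArcs (extend (d , b , just a)) ≟ I ⟧ * ⟦ futureSemiArcs (extend (d , b , just a)) ≟ J ⟧) ≡
    ⟦ i + bit b ≟ suc I ⟧ * (⟦ CanClose? d (just a) ⟧ * ⟦ flaggedAfterRemoving a ≟ J ⟧)
  counted-close b a = by-closability (CanClose? d (just a))
    where
    e = extend (d , b , just a)
    by-closability : (can? : Dec (CanClose d (just a))) →
      ⟦ can? ⟧ * (⟦ semiArcs e ≟ I ⟧ * ⟦ futureSemiArcs e ≟ J ⟧) ≡ ⟦ i + bit b ≟ suc I ⟧ * (⟦ can? ⟧ * ⟦ flaggedAfterRemoving a ≟ J ⟧)
    by-closability (no _) = sym (ℕₚ.*-zeroʳ ⟦ i + bit b ≟ suc I ⟧)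
    by-closability (yes can-close) = begin
      1 * (⟦ semiArcs e ≟ I ⟧ * ⟦ futureSemiArcs e ≟ J ⟧) ≡⟨ ℕₚ.*-identityˡ _ ⟩
      ⟦ semiArcs e ≟ I ⟧ * ⟦ futureSemiArcs e ≟ J ⟧       ≡⟨ cong₂ _*_ (⟦⟧-cong (semiArcs e ≟ I) (i + bit b ≟ suc I) to from)
                                                                      (cong (λ x → ⟦ x ≟ J ⟧) (futureSemiArcs-extend-close d b a can-close)) ⟩
      ⟦ i + bit b ≟ suc I ⟧ * ⟦ flaggedAfterRemoving a ≟ J ⟧ ≡⟨ cong (⟦ i + bit b ≟ suc I ⟧ *_) (ℕₚ.*-identityˡ _) ⟨
      ⟦ i + bit b ≟ suc I ⟧ * (1 * ⟦ flaggedAfterRemoving a ≟ J ⟧) ∎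
      where
      open ≡-Reasoning
      removed = semiArcs-extend-close d b a can-close
      to : semiArcs e ≡ I → i + bit b ≡ suc I
      to refl = trans (sym removed) (ℕₚ.+-comm _ 1)
      from : i + bit b ≡ suc I → semiArcs e ≡ I
      from i+b≡1+I = ℕₚ.suc-injective (trans (ℕₚ.+-comm 1 _) (trans removed i+b≡1+I))

  counted-choices : ∀ b → ∑[ m ∈ maybeFins n ] counted (b , m) ≡
    ⟦ i + bit b ≟ I ⟧ * ⟦ j ≟ J ⟧ + ⟦ i + bit b ≟ suc I ⟧ * closings i j J
  counted-choices b = cong₂ _+_ (counted-open b) (begin
    ∑ˡ (map just (allFin n)) (λ m → counted (b , m))                                 ≡⟨ ∑ˡ-map just (allFin n) _ ⟩
    ∑[ a ∈ allFin n ] counted (b , just a)                                          ≡⟨ ∑ˡ-allFin n _ ⟩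
    ∑[ a < n ] counted (b , just a)                                                 ≡⟨ sum-cong-≗ {n} (counted-close b) ⟩
    ∑[ a < n ] (⟦ i + bit b ≟ suc I ⟧ * closable a)                                 ≡⟨ sum-cong-≗ {n} (λ a → ℕₚ.*-comm ⟦ i + bit b ≟ suc I ⟧ (closable a)) ⟩
    ∑[ a < n ] (closable a * ⟦ i + bit b ≟ suc I ⟧)                                 ≡⟨ *-distribʳ-sum ⟦ i + bit b ≟ suc I ⟧ closable ⟨
    ∑[ a < n ] closable a * ⟦ i + bit b ≟ suc I ⟧                                   ≡⟨ cong (_* ⟦ i + bit b ≟ suc I ⟧) closable-count ⟩
    closings i j J * ⟦ i + bit b ≟ suc I ⟧                                          ≡⟨ ℕₚ.*-comm (closings i j J) _ ⟩
    ⟦ i + bit b ≟ suc I ⟧ * closings i j J                                          ∎)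
    where
    open ≡-Reasoning
    closable : Fin n → ℕ
    closable a = ⟦ CanClose? d (just a) ⟧ * ⟦ flaggedAfterRemoving a ≟ J ⟧

  ∑-choices : ∑[ c ∈ choices n ] ⟦ CountedExtension? n I J (d , c) ⟧ ≡ ⟦ Valid? d ⟧ * extensionCount I J i j
  ∑-choices = begin
    ∑[ c ∈ choices n ] ⟦ CountedExtension? n I J (d , c) ⟧
      ≡⟨ ∑ˡ-cong (choices n) split ⟩
    ∑[ c ∈ choices n ] (⟦ Valid? d ⟧ * counted c)
      ≡⟨ *-distribˡ-∑ˡ ⟦ Valid? d ⟧ (choices n) counted ⟨
    ⟦ Valid? d ⟧ * ∑ˡ (choices n) counted
      ≡⟨ cong (⟦ Valid? d ⟧ *_) (trans (∑ˡ-concatMap (λ b → map (b ,_) (maybeFins n)) (false ∷ true ∷ []) counted)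
                                 (∑ˡ-cong (false ∷ true ∷ []) (λ b → trans (∑ˡ-map (b ,_) (maybeFins n) counted) (counted-choices b)))) ⟩
    ⟦ Valid? d ⟧ * extensionCount I J i j ∎
    where
    open ≡-Reasoning
    split : ∀ c → ⟦ CountedExtension? n I J (d , c) ⟧ ≡ ⟦ Valid? d ⟧ * counted c
    split c = trans (⟦⟧-× (Valid? d) (closable ×-dec semis ×-dec futures))
      (cong (⟦ Valid? d ⟧ *_) (trans (⟦⟧-× closable (semis ×-dec futures)) (cong (⟦ closable ⟧ *_) (⟦⟧-× semis futures))))
      where
      closable = CanClose? d (proj₂ c)
      semis = semiArcs (extend (d , c)) ≟ I
      futures = futureSemiArcs (extend (d , c)) ≟ J

prefixSum : (ℕ → ℕ) → ℕ → ℕ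
prefixSum f zero = f zero
prefixSum f (suc k) = prefixSum f k + f (suc k)

closingCount : ℕ → ℕ → ℕ → ℕ
closingCount n a J = prefixSum (Acount n a) J * ⟦ J <? a ⟧ + Acount n a (suc J)

shiftedAcount : ℕ → ℕ → ℕ → ℕ
shiftedAcount n zero J = 0
shiftedAcount n (suc I) J = Acount n I J

⟦+1≟suc⟧ : ∀ x I → ⟦ x + 1 ≟ suc I ⟧ ≡ ⟦ x ≟ I ⟧
⟦+1≟suc⟧ x I =
  ⟦⟧-cong (x + 1 ≟ suc I) (x ≟ I) (λ eq → ℕₚ.suc-injective (trans (ℕₚ.+-comm 1 x) eq)) (λ { refl → ℕₚ.+-comm x 1 })

module _ (n : ℕ) where

  sumValid : (ℕ → ℕ → ℕ) → ℕ
  sumValid G = ∑[ d ∈ allCodes n ] (⟦ Valid? d ⟧ * G (semiArcs d) (futureSemiArcs d))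

  sumValid-cong : ∀ {G H} → (∀ x y → G x y ≡ H x y) → sumValid G ≡ sumValid H
  sumValid-cong G≗H = ∑ˡ-cong (allCodes n) (λ d → cong (⟦ Valid? d ⟧ *_) (G≗H _ _))

  sumValid-+ : ∀ G H → sumValid (λ x y → G x y + H x y) ≡ sumValid G + sumValid H
  sumValid-+ G H = trans (∑ˡ-cong (allCodes n) (λ d → ℕₚ.*-distribˡ-+ ⟦ Valid? d ⟧ _ _)) (∑ˡ-distrib-+ (allCodes n) _ _)

  sumValid-*ʳ : ∀ G c → sumValid (λ x y → G x y * c) ≡ sumValid G * c
  sumValid-*ʳ G c = trans (∑ˡ-cong (allCodes n) (λ d → sym (ℕₚ.*-assoc ⟦ Valid? d ⟧ _ c))) (sym (*-distribʳ-∑ˡ c (allCodes n) _))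

  sumValid-zero : ∀ G → (∀ x y → G x y ≡ 0) → sumValid G ≡ 0
  sumValid-zero G G≗0 = ∑ˡ-zero (allCodes n) (λ d → trans (cong (⟦ Valid? d ⟧ *_) (G≗0 _ _)) (ℕₚ.*-zeroʳ ⟦ Valid? d ⟧))

  sumValid-point : ∀ a b → sumValid (λ x y → ⟦ x ≟ a ⟧ * ⟦ y ≟ b ⟧) ≡ Acount n a b
  sumValid-point a b = sym (trans (length-filter _ (allCodes n)) (∑ˡ-cong (allCodes n) split))
    where
    split : ∀ d → ⟦ IsDiagram? d ×-dec NonNesting3? d ×-dec semiArcs d ≟ a ×-dec futureSemiArcs d ≟ b ⟧ ≡
                  ⟦ Valid? d ⟧ * (⟦ semiArcs d ≟ a ⟧ * ⟦ futureSemiArcs d ≟ b ⟧)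
    split d = begin
      ⟦ D ×-dec N ×-dec S ×-dec F ⟧   ≡⟨ ⟦⟧-× D (N ×-dec S ×-dec F) ⟩
      ⟦ D ⟧ * ⟦ N ×-dec S ×-dec F ⟧   ≡⟨ cong (⟦ D ⟧ *_) (trans (⟦⟧-× N (S ×-dec F)) (cong (⟦ N ⟧ *_) (⟦⟧-× S F))) ⟩
      ⟦ D ⟧ * (⟦ N ⟧ * (⟦ S ⟧ * ⟦ F ⟧)) ≡⟨ ℕₚ.*-assoc ⟦ D ⟧ ⟦ N ⟧ _ ⟨
      ⟦ D ⟧ * ⟦ N ⟧ * (⟦ S ⟧ * ⟦ F ⟧)   ≡⟨ cong (_* (⟦ S ⟧ * ⟦ F ⟧)) (⟦⟧-× D N) ⟨
      ⟦ D ×-dec N ⟧ * (⟦ S ⟧ * ⟦ F ⟧)   ∎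
      where
      open ≡-Reasoning
      D = IsDiagram? d
      N = NonNesting3? d
      S = semiArcs d ≟ a
      F = futureSemiArcs d ≟ b

  sumValid-prefix : ∀ a J → sumValid (λ x y → ⟦ x ≟ a ⟧ * ⟦ y ≤? J ⟧) ≡ prefixSum (Acount n a) J
  sumValid-prefix a zero = trans (sumValid-cong (λ x y → cong (⟦ x ≟ a ⟧ *_) (⟦⟧-cong (y ≤? 0) (y ≟ 0) ℕₚ.n≤0⇒n≡0 (λ { refl → z≤n }))))
                                 (sumValid-point a 0)
  sumValid-prefix a (suc J) = begin
    sumValid (λ x y → ⟦ x ≟ a ⟧ * ⟦ y ≤? suc J ⟧)
      ≡⟨ sumValid-cong (λ x y → trans (cong (⟦ x ≟ a ⟧ *_) (split y)) (ℕₚ.*-distribˡ-+ ⟦ x ≟ a ⟧ ⟦ y ≤? J ⟧ ⟦ y ≟ suc J ⟧)) ⟩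
    sumValid (λ x y → ⟦ x ≟ a ⟧ * ⟦ y ≤? J ⟧ + ⟦ x ≟ a ⟧ * ⟦ y ≟ suc J ⟧)
      ≡⟨ sumValid-+ (λ x y → ⟦ x ≟ a ⟧ * ⟦ y ≤? J ⟧) (λ x y → ⟦ x ≟ a ⟧ * ⟦ y ≟ suc J ⟧) ⟩
    sumValid (λ x y → ⟦ x ≟ a ⟧ * ⟦ y ≤? J ⟧) + sumValid (λ x y → ⟦ x ≟ a ⟧ * ⟦ y ≟ suc J ⟧)
      ≡⟨ cong₂ _+_ (sumValid-prefix a J) (sumValid-point a (suc J)) ⟩
    prefixSum (Acount n a) J + Acount n a (suc J) ∎
    where
    open ≡-Reasoning
    split : ∀ y → ⟦ y ≤? suc J ⟧ ≡ ⟦ y ≤? J ⟧ + ⟦ y ≟ suc J ⟧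
    split y with y ≤? J | y ≟ suc J
    ... | yes y≤J | _ = trans (⟦⟧-yes (y ≤? suc J) (ℕₚ.m≤n⇒m≤1+n y≤J))
      (sym (cong₂ _+_ (⟦⟧-yes (y ≤? J) y≤J) (⟦⟧-no (y ≟ suc J) λ { refl → ℕₚ.<-irrefl refl y≤J })))
    ... | no y≰J | yes refl = trans (⟦⟧-yes (suc J ≤? suc J) ℕₚ.≤-refl)
      (sym (cong₂ _+_ (⟦⟧-no (suc J ≤? J) y≰J) (⟦⟧-yes (suc J ≟ suc J) refl)))
    ... | no y≰J | no y≢1+J = trans (⟦⟧-no (y ≤? suc J) (λ y≤1+J → y≢1+J (ℕₚ.≤-antisym y≤1+J (ℕₚ.≰⇒> y≰J))))
      (sym (cong₂ _+_ (⟦⟧-no (y ≤? J) y≰J) (⟦⟧-no (y ≟ suc J) y≢1+J)))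

  sumValid-closings : ∀ a J → sumValid (λ x y → ⟦ x ≟ a ⟧ * closings x y J) ≡ closingCount n a J
  sumValid-closings a J = begin
    sumValid (λ x y → ⟦ x ≟ a ⟧ * closings x y J)
      ≡⟨ sumValid-cong (λ x y → trans (ℕₚ.*-distribˡ-+ ⟦ x ≟ a ⟧ (inRange y x J) ⟦ y ≟ suc J ⟧) (cong (_+ ⟦ x ≟ a ⟧ * ⟦ y ≟ suc J ⟧) (fix-upper x y))) ⟩
    sumValid (λ x y → ⟦ x ≟ a ⟧ * ⟦ y ≤? J ⟧ * ⟦ J <? a ⟧ + ⟦ x ≟ a ⟧ * ⟦ y ≟ suc J ⟧)
      ≡⟨ sumValid-+ (λ x y → ⟦ x ≟ a ⟧ * ⟦ y ≤? J ⟧ * ⟦ J <? a ⟧) (λ x y → ⟦ x ≟ a ⟧ * ⟦ y ≟ suc J ⟧) ⟩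
    sumValid (λ x y → ⟦ x ≟ a ⟧ * ⟦ y ≤? J ⟧ * ⟦ J <? a ⟧) + sumValid (λ x y → ⟦ x ≟ a ⟧ * ⟦ y ≟ suc J ⟧)
      ≡⟨ cong₂ _+_ (trans (sumValid-*ʳ (λ x y → ⟦ x ≟ a ⟧ * ⟦ y ≤? J ⟧) ⟦ J <? a ⟧) (cong (_* ⟦ J <? a ⟧) (sumValid-prefix a J)))
                   (sumValid-point a (suc J)) ⟩
    closingCount n a J ∎
    where
    open ≡-Reasoning
    fix-upper : ∀ x y → ⟦ x ≟ a ⟧ * inRange y x J ≡ ⟦ x ≟ a ⟧ * ⟦ y ≤? J ⟧ * ⟦ J <? a ⟧
    fix-upper x y with x ≟ a
    ... | yes refl = sym (ℕₚ.*-assoc ⟦ x ≟ x ⟧ ⟦ y ≤? J ⟧ ⟦ J <? x ⟧)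
    ... | no x≢a = trans (cong (_* inRange y x J) (⟦⟧-no (x ≟ a) x≢a))
                         (sym (cong (λ z → z * ⟦ y ≤? J ⟧ * ⟦ J <? a ⟧) (⟦⟧-no (x ≟ a) x≢a)))

  sumValid-shifted : ∀ I J → sumValid (λ x y → ⟦ x + 1 ≟ I ⟧ * ⟦ y ≟ J ⟧) ≡ shiftedAcount n I J
  sumValid-shifted zero J = sumValid-zero _ (λ x y → cong (_* ⟦ y ≟ J ⟧) (⟦⟧-no (x + 1 ≟ 0) (ℕₚ.m+1+n≢0 x)))
  sumValid-shifted (suc I) J = trans (sumValid-cong (λ x y → cong (_* ⟦ y ≟ J ⟧) (⟦+1≟suc⟧ x I))) (sumValid-point I J)

Acount-recurrence : ∀ n I J →
  Acount (suc n) I J ≡ (Acount n I J + shiftedAcount n I J) + (closingCount n I J + closingCount n (suc I) J)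
Acount-recurrence n I J = begin
  Acount (suc n) I J
    ≡⟨ Acount-suc n I J ⟩
  ∑[ d ∈ allCodes n ] ∑[ c ∈ choices n ] ⟦ CountedExtension? n I J (d , c) ⟧
    ≡⟨ ∑ˡ-cong (allCodes n) (λ d → ∑-choices d I J) ⟩
  sumValid n (extensionCount I J)
    ≡⟨ sumValid-cong n regroup ⟩
  sumValid n (λ x y → (point x y + shifted x y) + (closing I x y + closing (suc I) x y))
    ≡⟨ sumValid-+ n (λ x y → point x y + shifted x y) (λ x y → closing I x y + closing (suc I) x y) ⟩
  sumValid n (λ x y → point x y + shifted x y) + sumValid n (λ x y → closing I x y + closing (suc I) x y)
    ≡⟨ cong₂ _+_ (trans (sumValid-+ n point shifted) (cong₂ _+_ (sumValid-point n I J) (sumValid-shifted n I J)))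
                 (trans (sumValid-+ n (closing I) (closing (suc I))) (cong₂ _+_ (sumValid-closings n I J) (sumValid-closings n (suc I) J))) ⟩
  (Acount n I J + shiftedAcount n I J) + (closingCount n I J + closingCount n (suc I) J) ∎
  where
  open ≡-Reasoning
  open +-*-Solver using (solve; _:+_; _:=_; con)
  point shifted : ℕ → ℕ → ℕ
  point x y = ⟦ x ≟ I ⟧ * ⟦ y ≟ J ⟧
  shifted x y = ⟦ x + 1 ≟ I ⟧ * ⟦ y ≟ J ⟧
  closing : ℕ → ℕ → ℕ → ℕ
  closing a x y = ⟦ x ≟ a ⟧ * closings x y J
  regroup : ∀ x y → extensionCount I J x y ≡ (point x y + shifted x y) + (closing I x y + closing (suc I) x y)
  regroup x y rewrite ℕₚ.+-identityʳ x | ⟦+1≟suc⟧ x I =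
    solve 4 (λ a b c d → (a :+ b) :+ ((c :+ d) :+ con 0) := (a :+ c) :+ (d :+ b)) refl
      (point x y) (closing (suc I) x y) (shifted x y) (closing I x y)

∑-mono-≤ : ∀ n {f g : Fin n → ℕ} → (∀ i → f i ≤ g i) → ∑[ i < n ] f i ≤ ∑[ i < n ] g i
∑-mono-≤ zero _ = z≤n
∑-mono-≤ (suc n) f≤g = ℕₚ.+-mono-≤ (f≤g zero) (∑-mono-≤ n (λ i → f≤g (suc i)))

futureSemiArcs≤semiArcs : ∀ {n} (d : Code n) → futureSemiArcs d ≤ semiArcs d
futureSemiArcs≤semiArcs {n} d = subst₂ _≤_ (sym (futureSemiArcs≡∑ d)) (sym (semiArcs≡size d)) (∑-mono-≤ n pointwise)
  where
  pointwise : ∀ s → ⟦ InFutureNest2? d s ⟧ ≤ ⟦ IsSemi? d s ⟧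
  pointwise s = ⟦⟧-mono (InFutureNest2? d s) (IsSemi? d s) proj₁

Acount-above : ∀ n i k → i ℕ.< k → Acount n i k ≡ 0
Acount-above n i k i<k = trans (length-filter counted? (allCodes n)) (∑ˡ-zero (allCodes n) (λ d →
  ⟦⟧-no (counted? d) λ (_ , _ , semis , futures) → ℕₚ.<⇒≱ i<k (subst₂ _≤_ futures semis (futureSemiArcs≤semiArcs d))))
  where
  counted? = λ (d : Code n) → IsDiagram? d ×-dec NonNesting3? d ×-dec semiArcs d ≟ i ×-dec futureSemiArcs d ≟ k

Bcount≡prefixSum : ∀ n i → Bcount n i ≡ prefixSum (Acount n i) i
Bcount≡prefixSum n i = begin
  Bcount n i                                                ≡⟨ length-filter _ (allCodes n) ⟩
  ∑[ d ∈ allCodes n ] ⟦ D d ×-dec N d ×-dec S d ⟧           ≡⟨ ∑ˡ-cong (allCodes n) split ⟩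
  sumValid n (λ x y → ⟦ x ≟ i ⟧ * ⟦ y ≤? i ⟧)               ≡⟨ sumValid-prefix n i i ⟩
  prefixSum (Acount n i) i                                  ∎
  where
  open ≡-Reasoning
  D = IsDiagram?
  N = NonNesting3?
  S = λ (d : Code n) → semiArcs d ≟ i
  split : ∀ d → ⟦ D d ×-dec N d ×-dec S d ⟧ ≡ ⟦ Valid? d ⟧ * (⟦ S d ⟧ * ⟦ futureSemiArcs d ≤? i ⟧)
  split d = trans (⟦⟧-× (D d) (N d ×-dec S d)) (trans (cong (⟦ D d ⟧ *_) (⟦⟧-× (N d) (S d)))
    (trans (sym (ℕₚ.*-assoc ⟦ D d ⟧ _ _)) (cong₂ _*_ (sym (⟦⟧-× (D d) (N d)))
      (sym (⟦⟧-absorb (S d) (futureSemiArcs d ≤? i) (λ { refl → futureSemiArcs≤semiArcs d }))))))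

open import Data.Integer.Base using (+_; -[1+_])

module _ (a : ℕ → ℕ) (I : ℕ) (δ : ℕ → ℤ) (a-vanishes : ∀ k → I ℕ.< k → a k ≡ 0)
         (δ-at : δ I ≡ + prefixSum a I) (δ-off : ∀ k → k ≢ I → δ k ≡ + 0) where

  sumUpTo-minus-total : ∀ j → sumUpTo (λ k → + a k ℤ.- δ k) j ≡ + (prefixSum a j * ⟦ j <? I ⟧)
  sumUpTo-minus-total zero with I ≟ 0
  ... | yes refl = trans (cong (λ x → + a 0 ℤ.- x) δ-at)
                         (trans (ℤₚ.+-inverseʳ (+ a 0)) (cong +_ (sym (*-⟦⟧-no (a 0) (0 <? 0) λ ()))))
  ... | no I≢0 = trans (cong (λ x → + a 0 ℤ.- x) (δ-off 0 (I≢0 ∘ sym)))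
                       (trans (ℤₚ.+-identityʳ (+ a 0)) (cong +_ (sym (*-⟦⟧-yes (a 0) (0 <? I) (ℕₚ.n≢0⇒n>0 I≢0)))))
  sumUpTo-minus-total (suc j) with ℕₚ.<-cmp (suc j) I
  ... | tri< 1+j<I _ _ = begin
    sumUpTo (λ k → + a k ℤ.- δ k) j ℤ.+ (+ a (suc j) ℤ.- δ (suc j))
      ≡⟨ cong₂ (λ x y → x ℤ.+ (+ a (suc j) ℤ.- y)) (sumUpTo-minus-total j) (δ-off (suc j) (ℕₚ.<⇒≢ 1+j<I)) ⟩
    + (prefixSum a j * ⟦ j <? I ⟧) ℤ.+ (+ a (suc j) ℤ.- + 0)
      ≡⟨ cong₂ (λ x y → + x ℤ.+ y) (*-⟦⟧-yes (prefixSum a j) (j <? I) (ℕₚ.<-trans (ℕₚ.n<1+n j) 1+j<I))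
                                   (ℤₚ.+-identityʳ (+ a (suc j))) ⟩
    + prefixSum a (suc j)
      ≡⟨ cong +_ (*-⟦⟧-yes (prefixSum a (suc j)) (suc j <? I) 1+j<I) ⟨
    + (prefixSum a (suc j) * ⟦ suc j <? I ⟧) ∎
    where open ≡-Reasoning
  ... | tri≈ _ refl _ = begin
    sumUpTo (λ k → + a k ℤ.- δ k) j ℤ.+ (+ a (suc j) ℤ.- δ (suc j))
      ≡⟨ cong₂ (λ x y → x ℤ.+ (+ a (suc j) ℤ.- y)) (sumUpTo-minus-total j) δ-at ⟩
    + (prefixSum a j * ⟦ j <? suc j ⟧) ℤ.+ (+ a (suc j) ℤ.- + prefixSum a (suc j))
      ≡⟨ cong (λ x → + x ℤ.+ (+ a (suc j) ℤ.- + prefixSum a (suc j))) (*-⟦⟧-yes (prefixSum a j) (j <? suc j) (ℕₚ.n<1+n j)) ⟩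
    + prefixSum a j ℤ.+ (+ a (suc j) ℤ.- + prefixSum a (suc j))
      ≡⟨ ℤₚ.+-assoc (+ prefixSum a j) (+ a (suc j)) (ℤ.- + prefixSum a (suc j)) ⟨
    + prefixSum a (suc j) ℤ.- + prefixSum a (suc j)
      ≡⟨ ℤₚ.+-inverseʳ (+ prefixSum a (suc j)) ⟩
    + 0
      ≡⟨ cong +_ (*-⟦⟧-no (prefixSum a (suc j)) (suc j <? suc j) (ℕₚ.<-irrefl refl)) ⟨
    + (prefixSum a (suc j) * ⟦ suc j <? suc j ⟧) ∎
    where open ≡-Reasoning
  ... | tri> _ 1+j≢I I<1+j = begin
    sumUpTo (λ k → + a k ℤ.- δ k) j ℤ.+ (+ a (suc j) ℤ.- δ (suc j))
      ≡⟨ cong₂ ℤ._+_ (sumUpTo-minus-total j) (cong₂ (λ x y → + x ℤ.- y) (a-vanishes (suc j) I<1+j) (δ-off (suc j) 1+j≢I)) ⟩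
    + (prefixSum a j * ⟦ j <? I ⟧) ℤ.+ + 0
      ≡⟨ cong (λ x → + x ℤ.+ + 0) (*-⟦⟧-no (prefixSum a j) (j <? I) (ℕₚ.≤⇒≯ (ℕₚ.≤-pred I<1+j))) ⟩
    + 0
      ≡⟨ cong +_ (*-⟦⟧-no (prefixSum a (suc j)) (suc j <? I) (ℕₚ.<⇒≯ I<1+j)) ⟨
    + (prefixSum a (suc j) * ⟦ suc j <? I ⟧) ∎
    where open ≡-Reasoning

closingSeries : Ser
closingSeries = div1-v (A ⊖ A[uv,1]) ⊕ div-v (A ⊖ A[u,0])

closingSeries-nonneg : ∀ m a j → closingSeries m (+ a) j ≡ + closingCount m a j
closingSeries-nonneg m a j = cong₂ ℤ._+_
  (sumUpTo-minus-total (Acount m a) a (A[uv,1] m (+ a)) (Acount-above m a) diagonal off-diagonal j)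
  (ℤₚ.+-identityʳ (+ Acount m a (suc j)))
  where
  diagonal : A[uv,1] m (+ a) a ≡ + prefixSum (Acount m a) a
  diagonal with a ≟ a
  ... | yes _ = cong +_ (Bcount≡prefixSum m a)
  ... | no a≢a = ⊥-elim (a≢a refl)
  off-diagonal : ∀ k → k ≢ a → A[uv,1] m (+ a) k ≡ + 0
  off-diagonal k k≢a with k ≟ a
  ... | yes k≡a = ⊥-elim (k≢a k≡a)
  ... | no _ = refl

closingSeries-neg : ∀ m k j → closingSeries m -[1+ k ] j ≡ + 0
closingSeries-neg m k j = cong₂ ℤ._+_ (sumUpTo-zero j) refl
  where
  sumUpTo-zero : ∀ j → sumUpTo (λ _ → + 0) j ≡ + 0
  sumUpTo-zero zero = refl
  sumUpTo-zero (suc j) = cong (ℤ._+ + 0) (sumUpTo-zero j)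

closingCount-zero : ∀ m j → closingCount m 0 j ≡ 0
closingCount-zero m j = cong₂ _+_ (ℕₚ.*-zeroʳ (prefixSum (Acount m 0) j)) (Acount-above m 0 (suc j) (s≤s z≤n))

A-shifted : ∀ m I j → A m (+ I ℤ.- + 1) j ≡ + shiftedAcount m I j
A-shifted m zero j = refl
A-shifted m (suc I) j = refl

corollary3 : ∀ (n : ℕ) (i : ℤ) (j : ℕ) →
    let X = div1-v (A ⊖ A[uv,1]) ⊕ div-v (A ⊖ A[u,0]) in
    A n i j ≡ (𝟙 ⊕ z· ((A ⊕ u· A) ⊕ (X ⊕ u⁻¹· X))) n i j
corollary3 zero (+ zero) zero = refl
corollary3 zero (+ zero) (suc j) = refl
corollary3 zero (+ suc I) j = refl
corollary3 zero -[1+ k ] j = refl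
corollary3 (suc m) (+ I) j = sym (begin
  + 0 ℤ.+ ((A m (+ I) j ℤ.+ A m (+ I ℤ.- + 1) j) ℤ.+ (closingSeries m (+ I) j ℤ.+ closingSeries m (+ (I + 1)) j))
    ≡⟨ ℤₚ.+-identityˡ _ ⟩
  (+ Acount m I j ℤ.+ A m (+ I ℤ.- + 1) j) ℤ.+ (closingSeries m (+ I) j ℤ.+ closingSeries m (+ (I + 1)) j)
    ≡⟨ cong₂ ℤ._+_ (cong (λ x → + Acount m I j ℤ.+ x) (A-shifted m I j))
                   (cong₂ ℤ._+_ (closingSeries-nonneg m I j)
                                (trans (cong (λ x → closingSeries m (+ x) j) (ℕₚ.+-comm I 1)) (closingSeries-nonneg m (suc I) j))) ⟩
  + ((Acount m I j + shiftedAcount m I j) + (closingCount m I j + closingCount m (suc I) j))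
    ≡⟨ cong +_ (Acount-recurrence m I j) ⟨
  + Acount (suc m) I j ∎)
  where open ≡-Reasoning
corollary3 (suc m) -[1+ k ] j = sym (trans (ℤₚ.+-identityˡ _) (trans (ℤₚ.+-identityˡ _)
  (cong₂ ℤ._+_ (closingSeries-neg m k j) (closingSeries-above k))))
  where
  closingSeries-above : ∀ k → closingSeries m (-[1+ k ] ℤ.+ + 1) j ≡ + 0
  closingSeries-above zero = trans (closingSeries-nonneg m 0 j) (cong +_ (closingCount-zero m j))
  closingSeries-above (suc k) = closingSeries-neg m k j
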